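{- Let $a,b,y$ be parameters (complex numbers with $y\neq1$, or indeterminates), let $$E(t,y;a,b)=\frac{(1-y)\,e^{a t(1-y)}}{1-y\,e^{bt(1-y)}},$$ and let $G(x,y;a,b)=\mathcal{T}(E(t,y;a,b))(x)$. Then $G(x,y;a,b)$ is the generating function of the moment sequence (the first column of the inverse matrix) of the family of orthogonal polynomials defined by the ordinary Riordan array $$\left(\frac{1+(a(y-1)+b)x}{1+b(1+y)x+b^2yx^2},\;\frac{x}{1+b(1+y)x+b^2yx^2}\right).$$
   Context: An ordinary Riordan array $(g,f)$, for power series $g(x)=1+g_1x+\cdots$ and $f(x)=f_1x+\cdots$ with $f_1\neq0$, is the lower-triangular matrix with $(n,k)$ entry $[x^n]g(x)f(x)^k$; its moment sequence is the first column of its inverse. Formal Sumudu transform: for $f(t)=\sum_{n\ge0} f_n \frac{t^n}{n!}$, $\mathcal{S}(f)(x)=\frac1x\int_0^\infty f(t)e^{ -t/x}dt$ is, formally, $\sum_{n\ge0} f_nx^n$. For $F(x)=x+\cdots$, $\mathrm{Rev}(F)$ is its compositional inverse. The transformation $\mathcal{T}$ applied to a power series $E(t)$ with $E(0)=1$: form $1/E(t)$, take $g(x)=\mathcal{S}(1/E)(x)$, and set $\mathcal{T}(E)(x)=\frac1x\mathrm{Rev}(x\,g(x))$. -}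

module Defs where

open import Level using (Level)
open import Data.Nat as ℕ using (ℕ; zero; suc; _∸_; pred)
open import Data.Nat.Properties using (_<?_; _≟_)
open import Relation.Nullary using (yes; no)
open import Algebra.Bundles using (CommutativeRing)

binom : ℕ → ℕ → ℕ
binom zero    zero    = 1
binom zero    (suc k) = 0
binom (suc n) zero    = 1
binom (suc n) (suc k) = binom n k ℕ.+ binom n (suc k)

module PowerSeries {c ℓ : Level} (R : CommutativeRing c ℓ) where
  open CommutativeRing R

  -- A formal power series over R is its coefficient sequence.
  -- For an ordinary series  f(x) = Σ fₙ xⁿ  this is n ↦ fₙ;
  -- for an exponential series f(t) = Σ fₙ tⁿ/n! this is n ↦ fₙ.
  Series : Set c
  Series = ℕ → Carrier

  _≋_ : Series → Series → Set ℓ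
  f ≋ g = ∀ n → f n ≈ g n

  natMul : ℕ → Carrier → Carrier
  natMul zero    x = 0#
  natMul (suc n) x = x + natMul n x

  pow : Carrier → ℕ → Carrier
  pow x zero    = 1#
  pow x (suc n) = x * pow x n

  sumTo : (ℕ → Carrier) → ℕ → Carrier
  sumTo h zero    = h 0
  sumTo h (suc n) = sumTo h n + h (suc n)

  oneS : Series
  oneS zero    = 1#
  oneS (suc n) = 0#

  scaleS : Carrier → Series → Series
  scaleS r f n = r * f n

  mulX : Series → Series
  mulX f zero    = 0#
  mulX f (suc n) = f n

  divX : Series → Series
  divX f n = f (suc n)

  _⊛_ : Series → Series → Series
  (f ⊛ g) n = sumTo (λ k → f k * g (n ∸ k)) n

  powS : Series → ℕ → Series
  powS f zero    = oneS
  powS f (suc k) = f ⊛ powS f k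

  ogfInvAux : Carrier → Series → ℕ → Series
  ogfInvAux c f zero    n       = 0#
  ogfInvAux c f (suc m) zero    = c
  ogfInvAux c f (suc m) (suc n) =
    - (c * sumTo (λ k → f (suc k) * ogfInvAux c f m (n ∸ k)) n)

  ogfInv : Carrier → Series → Series
  ogfInv c f n = ogfInvAux c f (suc n) n

  -- R = Rev(F) is the unique series with
  -- R₀ = 0 and F(R(x)) = x, i.e. R₁ = c and, for n ≥ 2,
  --   F₁ Rₙ + Σ_{k=2}^{n} F_k [xⁿ] R^k = 0 .
  -- (Computed with fuel; fuel n+1 suffices for the n-th coefficient.)
  revAux : Carrier → Series → ℕ → Series
  revAux c F zero    n             = 0#
  revAux c F (suc m) zero          = 0#
  revAux c F (suc m) (suc zero)    = c
  revAux c F (suc m) (suc (suc n)) =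
    - (c * sumTo (λ k → F (suc (suc k)) * powS (revAux c F m) (suc (suc k)) (suc (suc n))) n)

  Rev : Carrier → Series → Series
  Rev c F n = revAux c F (suc n) n

  -- binomial convolution = product of exponential generating functions
  _⊙_ : Series → Series → Series
  (f ⊙ g) n = sumTo (λ k → natMul (binom n k) (f k * g (n ∸ k))) n

  expS : Carrier → Series
  expS r n = pow r n

  egfInvAux : Carrier → Series → ℕ → Series
  egfInvAux c f zero    n       = 0#
  egfInvAux c f (suc m) zero    = c
  egfInvAux c f (suc m) (suc n) =
    - (c * sumTo (λ k → natMul (binom (suc n) (suc k)) (f (suc k) * egfInvAux c f m (n ∸ k))) n)

  egfInv : Carrier → Series → Series
  egfInv c f n = egfInvAux c f (suc n) n

  -- Formal Sumudu transform: Σ fₙ tⁿ/n!  ↦  Σ fₙ xⁿ.  On coefficient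
  -- sequences this is the identity map (exponential ↦ ordinary reading).
  sumudu : Series → Series
  sumudu f n = f n

  -- The transformation 𝒯 for E with E(0) = 1:
  --   g = 𝒮(1/E),   𝒯(E)(x) = (1/x) Rev(x g(x)).
  -- Here 1/E uses the inverse 1 of E(0) = 1, and Rev uses the inverse 1 of
  -- the linear coefficient g(0) = 1/E(0) = 1.
  𝒯 : Series → Series
  𝒯 E = divX (Rev 1# (mulX (sumudu (egfInv 1# E))))

  Matrix : Set c
  Matrix = ℕ → ℕ → Carrier

  riordan : Series → Series → Matrix
  riordan g f n k = (g ⊛ powS f k) n

  uniInvAux : Matrix → ℕ → Matrix
  uniInvAux M zero    n k = 0#
  uniInvAux M (suc m) n k with n <? k | n ≟ k
  ... | yes _ | _     = 0#
  ... | no _  | yes _ = 1#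
  ... | no _  | no _  = - sumTo (λ j → M n j * uniInvAux M m j k) (pred n)

  uniInv : Matrix → Matrix
  uniInv M n k = uniInvAux M (suc n) n k

  moments : Matrix → Series
  moments M n = uniInv M n 0

  -- The specific objects of the theorem, for parameters a b y and an
  -- inverse u of (1 - y).

  denE : Carrier → Carrier → Series
  denE b y n = oneS n - y * pow (b * (1# - y)) n

  Eser : Carrier → Carrier → Carrier → Carrier → Series
  Eser a b y u = scaleS (1# - y) (expS (a * (1# - y))) ⊙ egfInv u (denE b y)

  quadD : Carrier → Carrier → Series
  quadD b y zero                = 1#
  quadD b y (suc zero)          = b * (1# + y)
  quadD b y (suc (suc zero))    = b * b * y
  quadD b y (suc (suc (suc n))) = 0#

  numG : Carrier → Carrier → Carrier → Series
  numG a b y zero          = 1#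
  numG a b y (suc zero)    = a * (y - 1#) + b
  numG a b y (suc (suc n)) = 0#

  riordanG riordanF : Carrier → Carrier → Carrier → Series
  riordanG a b y = numG a b y ⊛ ogfInv 1# (quadD b y)
  riordanF a b y = mulX (ogfInv 1# (quadD b y))

  riordanArray : Carrier → Carrier → Carrier → Matrix
  riordanArray a b y = riordan (riordanG a b y) (riordanF a b y)

-- With p = a(y − 1), s = b(1 − y), q = s + p and β = b + p one has
-- 1/E = u (e^{pt} − y e^{qt}), so g = 𝒮(1/E) = u (1/(1 − px) − y/(1 − qx)).
-- Writing Rev(x g) = x T, the identity x = xT · g(xT) clears denominators to
-- T (1 − β x T) = (1 − p x T)(1 − q x T).  Substituting the Riordan multiplier
-- F = x/Q, Q = 1 + b(1+y)x + b²yx², gives the same quadratic in F for T(F); it is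
-- also solved by Q/N with N = 1 + βx, and its solution is unique because F has no
-- constant term.  Hence T(F) = Q/N = 1/G, which by the fundamental theorem of
-- Riordan arrays says that T solves M T = e₀, i.e. T is the first column of M⁻¹.

module Submission where

open import Level using (_⊔_)
open import Algebra.Bundles using (CommutativeRing)
open import Data.Nat as ℕ using (ℕ; zero; suc; _∸_; z≤n; s≤s)
import Data.Nat.Properties as ℕ
open import Data.Nat.Induction using (<-rec)
open import Data.Integer as ℤ using (ℤ; +_; -[1+_]; _⊖_; ∣_∣; sign)
import Data.Integer.Properties as ℤ
open import Data.Sign as Sign using (Sign)
open import Data.Maybe using (Maybe; just; nothing)
open import Data.Product using (_×_; _,_)
open import Data.Sum using (inj₁; inj₂)
open import Relation.Nullary using (yes; no)
open import Relation.Binary.Bundles using (Setoid)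
open import Relation.Binary.Structures using (IsEquivalence)
open import Relation.Binary.PropositionalEquality as ≡ using (_≡_)
import Algebra.Solver.Ring.AlmostCommutativeRing as ACR
import Algebra.Solver.Ring
import Relation.Binary.Reasoning.Setoid as SetoidReasoning

open import Defs

module IntegerCoefficients {c ℓ} (R : CommutativeRing c ℓ) where
  open CommutativeRing R
  open import Algebra.Properties.Ring ring using (-‿involutive; -0#≈0#; -‿distribˡ-*; -‿+-comm)
  open import Algebra.Properties.Semiring.Mult.TCOptimised semiring using (×-homo-+; ×1-homo-*)
    renaming (_×_ to _×ₙ_)
  open import Relation.Binary.Reasoning.Setoid setoid

  fromℤ : ℤ → Carrier
  fromℤ (+ n)    = n ×ₙ 1#
  fromℤ -[1+ n ] = - (suc n ×ₙ 1#)

  fromSign : Sign → Carrier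
  fromSign Sign.+ = 1#
  fromSign Sign.- = - 1#

  private
    x-0≈x : ∀ x → x - 0# ≈ x
    x-0≈x x = trans (+-congˡ -0#≈0#) (+-identityʳ x)

    1+x-[1+y]≈x-y : ∀ x y → (1# + x) - (1# + y) ≈ x - y
    1+x-[1+y]≈x-y x y = begin
      (1# + x) + - (1# + y)   ≈⟨ +-congˡ (sym (-‿+-comm 1# y)) ⟩
      (1# + x) + (- 1# + - y) ≈⟨ +-congʳ (+-comm 1# x) ⟩
      (x + 1#) + (- 1# + - y) ≈⟨ +-assoc x 1# _ ⟩
      x + (1# + (- 1# + - y)) ≈⟨ +-congˡ (sym (+-assoc 1# (- 1#) (- y))) ⟩
      x + ((1# - 1#) + - y)   ≈⟨ +-congˡ (+-congʳ (-‿inverseʳ 1#)) ⟩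
      x + (0# + - y)          ≈⟨ +-congˡ (+-identityˡ (- y)) ⟩
      x - y                   ∎

    interchange : ∀ w x y z → (w * x) * (y * z) ≈ (w * y) * (x * z)
    interchange w x y z = begin
      (w * x) * (y * z) ≈⟨ *-assoc w x _ ⟩
      w * (x * (y * z)) ≈⟨ *-congˡ (sym (*-assoc x y z)) ⟩
      w * ((x * y) * z) ≈⟨ *-congˡ (*-congʳ (*-comm x y)) ⟩
      w * ((y * x) * z) ≈⟨ *-congˡ (*-assoc y x z) ⟩
      w * (y * (x * z)) ≈⟨ sym (*-assoc w y _) ⟩
      (w * y) * (x * z) ∎

  fromℤ-⊖ : ∀ m n → fromℤ (m ⊖ n) ≈ m ×ₙ 1# - n ×ₙ 1#
  fromℤ-⊖ zero    zero    = sym (x-0≈x 0#)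
  fromℤ-⊖ (suc m) zero    = sym (x-0≈x _)
  fromℤ-⊖ zero    (suc n) = sym (+-identityˡ _)
  fromℤ-⊖ (suc m) (suc n) = begin
    fromℤ (suc m ⊖ suc n)           ≡⟨ ≡.cong fromℤ (ℤ.[1+m]⊖[1+n]≡m⊖n m n) ⟩
    fromℤ (m ⊖ n)                   ≈⟨ fromℤ-⊖ m n ⟩
    m ×ₙ 1# - n ×ₙ 1#                 ≈⟨ 1+x-[1+y]≈x-y _ _ ⟨
    (1# + m ×ₙ 1#) - (1# + n ×ₙ 1#)   ≈⟨ +-cong (×-homo-+ 1# 1 m) (-‿cong (×-homo-+ 1# 1 n)) ⟨
    suc m ×ₙ 1# - suc n ×ₙ 1#         ∎

  fromℤ-+ : ∀ i j → fromℤ (i ℤ.+ j) ≈ fromℤ i + fromℤ j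
  fromℤ-+ (+ m)    (+ n)    = ×-homo-+ 1# m n
  fromℤ-+ (+ m)    -[1+ n ] = fromℤ-⊖ m (suc n)
  fromℤ-+ -[1+ m ] (+ n)    = trans (fromℤ-⊖ n (suc m)) (+-comm _ _)
  fromℤ-+ -[1+ m ] -[1+ n ] = begin
    - (suc (suc (m ℕ.+ n)) ×ₙ 1#)       ≡⟨ ≡.cong (λ k → - (suc k ×ₙ 1#)) (ℕ.+-suc m n) ⟨
    - ((suc m ℕ.+ suc n) ×ₙ 1#)         ≈⟨ -‿cong (×-homo-+ 1# (suc m) (suc n)) ⟩
    - (suc m ×ₙ 1# + suc n ×ₙ 1#)        ≈⟨ -‿+-comm _ _ ⟨
    - (suc m ×ₙ 1#) + - (suc n ×ₙ 1#)    ∎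

  fromℤ-neg : ∀ i → fromℤ (ℤ.- i) ≈ - fromℤ i
  fromℤ-neg (+ zero)  = sym -0#≈0#
  fromℤ-neg (+ suc n) = refl
  fromℤ-neg -[1+ n ]  = sym (-‿involutive _)

  fromSign-* : ∀ s t → fromSign (s Sign.* t) ≈ fromSign s * fromSign t
  fromSign-* Sign.+ t      = sym (*-identityˡ _)
  fromSign-* Sign.- Sign.+ = sym (*-identityʳ _)
  fromSign-* Sign.- Sign.- = begin
    1#            ≈⟨ -‿involutive 1# ⟨
    - - 1#        ≈⟨ -‿cong (*-identityˡ (- 1#)) ⟨
    - (1# * - 1#) ≈⟨ -‿distribˡ-* 1# (- 1#) ⟩
    - 1# * - 1#   ∎

  fromℤ-◃ : ∀ s n → fromℤ (s ℤ.◃ n) ≈ fromSign s * n ×ₙ 1#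
  fromℤ-◃ s      zero    = sym (zeroʳ _)
  fromℤ-◃ Sign.+ (suc n) = sym (*-identityˡ _)
  fromℤ-◃ Sign.- (suc n) = trans (-‿cong (sym (*-identityˡ _))) (-‿distribˡ-* _ _)

  fromℤ≈sign*abs : ∀ i → fromℤ i ≈ fromSign (sign i) * ∣ i ∣ ×ₙ 1#
  fromℤ≈sign*abs (+ n)    = sym (*-identityˡ _)
  fromℤ≈sign*abs -[1+ n ] = fromℤ-◃ Sign.- (suc n)

  fromℤ-* : ∀ i j → fromℤ (i ℤ.* j) ≈ fromℤ i * fromℤ j
  fromℤ-* i j = begin
    fromℤ ((sign i Sign.* sign j) ℤ.◃ (∣ i ∣ ℕ.* ∣ j ∣))            ≈⟨ fromℤ-◃ (sign i Sign.* sign j) (∣ i ∣ ℕ.* ∣ j ∣) ⟩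
    fromSign (sign i Sign.* sign j) * (∣ i ∣ ℕ.* ∣ j ∣) ×ₙ 1#        ≈⟨ *-cong (fromSign-* (sign i) (sign j)) (×1-homo-* ∣ i ∣ ∣ j ∣) ⟩
    (fromSign (sign i) * fromSign (sign j)) * (∣ i ∣ ×ₙ 1# * ∣ j ∣ ×ₙ 1#) ≈⟨ interchange _ _ _ _ ⟩
    (fromSign (sign i) * ∣ i ∣ ×ₙ 1#) * (fromSign (sign j) * ∣ j ∣ ×ₙ 1#) ≈⟨ *-cong (fromℤ≈sign*abs i) (fromℤ≈sign*abs j) ⟨
    fromℤ i * fromℤ j                                                 ∎

  fromℤ-homomorphism : ℤ.+-*-rawRing ACR.-Raw-AlmostCommutative⟶ ACR.fromCommutativeRing R
  fromℤ-homomorphism = record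
    { ⟦_⟧ = fromℤ ; +-homo = fromℤ-+ ; *-homo = fromℤ-* ; -‿homo = fromℤ-neg
    ; 0-homo = refl ; 1-homo = refl }

  fromℤ-≟ : ∀ i j → Maybe (fromℤ i ≈ fromℤ j)
  fromℤ-≟ i j with i ℤ.≟ j
  ... | yes ≡.refl = just refl
  ... | no _       = nothing

  open Algebra.Solver.Ring ℤ.+-*-rawRing (ACR.fromCommutativeRing R) fromℤ-homomorphism fromℤ-≟ public

module FormalSeries {c ℓ} (R : CommutativeRing c ℓ) where
  open CommutativeRing R
  open PowerSeries R
  open import Algebra.Properties.Ring ring using (-‿distribˡ-*; -‿+-comm)
  open SetoidReasoning setoid
  private module Scalar = IntegerCoefficients R

  x*0≈0 : ∀ x {z} → z ≈ 0# → x * z ≈ 0#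
  x*0≈0 x z≈0 = trans (*-congˡ z≈0) (zeroʳ x)

  0*x≈0 : ∀ {z} x → z ≈ 0# → z * x ≈ 0#
  0*x≈0 x z≈0 = trans (*-congʳ z≈0) (zeroˡ x)

  private
    x+[y+z]≈y+[x+z] : ∀ x y z → x + (y + z) ≈ y + (x + z)
    x+[y+z]≈y+[x+z] = solve 3 (λ x y z → x :+ (y :+ z) := y :+ (x :+ z)) refl
      where open Scalar

    [w+x]+[y+z]≈[w+y]+[x+z] : ∀ w x y z → (w + x) + (y + z) ≈ (w + y) + (x + z)
    [w+x]+[y+z]≈[w+y]+[x+z] = solve 4 (λ w x y z → (w :+ x) :+ (y :+ z) := (w :+ y) :+ (x :+ z)) refl
      where open Scalar

  sumTo-cong≤ : ∀ {h h′ : ℕ → Carrier} n → (∀ k → k ℕ.≤ n → h k ≈ h′ k) → sumTo h n ≈ sumTo h′ n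
  sumTo-cong≤ zero    h≈h′ = h≈h′ 0 z≤n
  sumTo-cong≤ (suc n) h≈h′ = +-cong (sumTo-cong≤ n (λ k k≤n → h≈h′ k (ℕ.m≤n⇒m≤1+n k≤n))) (h≈h′ (suc n) ℕ.≤-refl)

  sumTo-cong : ∀ {h h′ : ℕ → Carrier} n → (∀ k → h k ≈ h′ k) → sumTo h n ≈ sumTo h′ n
  sumTo-cong n h≈h′ = sumTo-cong≤ n (λ k _ → h≈h′ k)

  sumTo-+ : ∀ (h h′ : ℕ → Carrier) n → sumTo (λ k → h k + h′ k) n ≈ sumTo h n + sumTo h′ n
  sumTo-+ h h′ zero    = refl
  sumTo-+ h h′ (suc n) = trans (+-congʳ (sumTo-+ h h′ n)) ([w+x]+[y+z]≈[w+y]+[x+z] _ _ _ _)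

  *-sumTo : ∀ x (h : ℕ → Carrier) n → x * sumTo h n ≈ sumTo (λ k → x * h k) n
  *-sumTo x h zero    = refl
  *-sumTo x h (suc n) = trans (distribˡ _ _ _) (+-congʳ (*-sumTo x h n))

  -‿sumTo : ∀ (h : ℕ → Carrier) n → - sumTo h n ≈ sumTo (λ k → - h k) n
  -‿sumTo h zero    = refl
  -‿sumTo h (suc n) = trans (sym (-‿+-comm _ _)) (+-congʳ (-‿sumTo h n))

  sumTo-zero : ∀ {h : ℕ → Carrier} n → (∀ k → k ℕ.≤ n → h k ≈ 0#) → sumTo h n ≈ 0#
  sumTo-zero n h≈0 = trans (sumTo-cong≤ n h≈0) (sumTo-const0 n)
    where
    sumTo-const0 : ∀ n → sumTo (λ _ → 0#) n ≈ 0#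
    sumTo-const0 zero    = refl
    sumTo-const0 (suc n) = trans (+-identityʳ _) (sumTo-const0 n)

  sumTo-unconsˡ : ∀ (h : ℕ → Carrier) n → sumTo h (suc n) ≈ h 0 + sumTo (λ k → h (suc k)) n
  sumTo-unconsˡ h zero    = refl
  sumTo-unconsˡ h (suc n) = trans (+-congʳ (sumTo-unconsˡ h n)) (+-assoc _ _ _)

  sumTo-init : ∀ (h : ℕ → Carrier) n → h (suc n) ≈ 0# → sumTo h (suc n) ≈ sumTo h n
  sumTo-init h n hₙ₊₁≈0 = trans (+-congˡ hₙ₊₁≈0) (+-identityʳ _)

  sumTo-comm : ∀ (f : ℕ → ℕ → Carrier) n m →
    sumTo (λ i → sumTo (f i) m) n ≈ sumTo (λ j → sumTo (λ i → f i j) n) m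
  sumTo-comm f zero    m = refl
  sumTo-comm f (suc n) m = trans (+-congʳ (sumTo-comm f n m)) (sym (sumTo-+ _ _ m))

  sumTo-extend : ∀ (h : ℕ → Carrier) {n N} → n ℕ.≤ N → (∀ k → n ℕ.< k → k ℕ.≤ N → h k ≈ 0#) →
    sumTo h n ≈ sumTo h N
  sumTo-extend h n≤N = go (ℕ.≤⇒≤′ n≤N)
    where
    go : ∀ {n N} → n ℕ.≤′ N → (∀ k → n ℕ.< k → k ℕ.≤ N → h k ≈ 0#) → sumTo h n ≈ sumTo h N
    go ℕ.≤′-refl                 _   = refl
    go {n} (ℕ.≤′-step {N} n≤′N) h≈0 = begin
      sumTo h n          ≈⟨ +-identityʳ _ ⟨
      sumTo h n + 0#     ≈⟨ +-cong (go n≤′N (λ k n<k k≤N → h≈0 k n<k (ℕ.m≤n⇒m≤1+n k≤N)))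
                                   (sym (h≈0 (suc N) (s≤s (ℕ.≤′⇒≤ n≤′N)) ℕ.≤-refl)) ⟩
      sumTo h N + h (suc N) ∎

  infixl 6 _⊕_

  _⊕_ : Series → Series → Series
  (f ⊕ g) n = f n + g n

  negS : Series → Series
  negS f n = - f n

  zeroS : Series
  zeroS _ = 0#

  constS : Carrier → Series
  constS x = scaleS x oneS

  X : Series
  X = mulX oneS

  ≋-isEquivalence : IsEquivalence _≋_
  ≋-isEquivalence = record
    { refl  = λ _ → refl
    ; sym   = λ f≋g n → sym (f≋g n)
    ; trans = λ f≋g g≋h n → trans (f≋g n) (g≋h n) }

  ≋-setoid : Setoid c ℓ
  ≋-setoid = record { isEquivalence = ≋-isEquivalence }

  open IsEquivalence ≋-isEquivalence public
    using () renaming (refl to ≋-refl; sym to ≋-sym; trans to ≋-trans)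

  ⊕-cong : ∀ {f f′ g g′} → f ≋ f′ → g ≋ g′ → (f ⊕ g) ≋ (f′ ⊕ g′)
  ⊕-cong f≋f′ g≋g′ n = +-cong (f≋f′ n) (g≋g′ n)

  negS-cong : ∀ {f f′} → f ≋ f′ → negS f ≋ negS f′
  negS-cong f≋f′ n = -‿cong (f≋f′ n)

  constS-cong : ∀ {x z} → x ≈ z → constS x ≋ constS z
  constS-cong x≈z n = *-congʳ x≈z

  constS-1 : constS 1# ≋ oneS
  constS-1 n = *-identityˡ _

  constS-difference : ∀ x z w → x - z ≈ w → (constS x ⊕ negS (constS z)) ≋ constS w
  constS-difference x z w x-z≈w n =
    trans (+-congˡ (-‿distribˡ-* z (oneS n))) (trans (sym (distribʳ _ _ _)) (*-congʳ x-z≈w))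

  seriesRing : (_⋆_ : Series → Series → Series) →
    (∀ {f f′ g g′} → f ≋ f′ → g ≋ g′ → (f ⋆ g) ≋ (f′ ⋆ g′)) →
    (∀ f g h → ((f ⋆ g) ⋆ h) ≋ (f ⋆ (g ⋆ h))) →
    (∀ f g → (f ⋆ g) ≋ (g ⋆ f)) →
    (∀ f → (oneS ⋆ f) ≋ f) →
    (∀ f g h → ((g ⊕ h) ⋆ f) ≋ ((g ⋆ f) ⊕ (h ⋆ f))) →
    CommutativeRing c ℓ
  seriesRing _⋆_ ⋆-cong ⋆-assoc ⋆-comm ⋆-identityˡ ⋆-distribʳ = record
    { Carrier = Series ; _≈_ = _≋_ ; _+_ = _⊕_ ; _*_ = _⋆_ ; -_ = negS ; 0# = zeroS ; 1# = oneS
    ; isCommutativeRing = record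
      { isRing = record
        { +-isAbelianGroup = record
          { isGroup = record
            { isMonoid = record
              { isSemigroup = record
                { isMagma = record { isEquivalence = ≋-isEquivalence ; ∙-cong = ⊕-cong }
                ; assoc = λ _ _ _ _ → +-assoc _ _ _ }
              ; identity = (λ _ _ → +-identityˡ _) , (λ _ _ → +-identityʳ _) }
            ; inverse = (λ _ _ → -‿inverseˡ _) , (λ _ _ → -‿inverseʳ _)
            ; ⁻¹-cong = negS-cong }
          ; comm = λ _ _ _ → +-comm _ _ }
        ; *-cong = ⋆-cong
        ; *-assoc = ⋆-assoc
        ; *-identity = ⋆-identityˡ , (λ f → ≋-trans (⋆-comm f oneS) (⋆-identityˡ f))
        ; distrib = (λ f g h → ≋-trans (⋆-comm f (g ⊕ h))
                      (≋-trans (⋆-distribʳ f g h) (⊕-cong (⋆-comm g f) (⋆-comm h f))))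
                  , ⋆-distribʳ }
      ; *-comm = ⋆-comm } }

  ⊛-cong≤ : ∀ {f f′ g g′} n → (∀ k → k ℕ.≤ n → f k ≈ f′ k) → (∀ k → k ℕ.≤ n → g k ≈ g′ k) →
    (f ⊛ g) n ≈ (f′ ⊛ g′) n
  ⊛-cong≤ n f≈f′ g≈g′ = sumTo-cong≤ n (λ k k≤n → *-cong (f≈f′ k k≤n) (g≈g′ (n ∸ k) (ℕ.m∸n≤m n k)))

  ⊛-cong : ∀ {f f′ g g′} → f ≋ f′ → g ≋ g′ → (f ⊛ g) ≋ (f′ ⊛ g′)
  ⊛-cong f≋f′ g≋g′ n = ⊛-cong≤ n (λ k _ → f≋f′ k) (λ k _ → g≋g′ k)

  divX-⊛ : ∀ f g → divX (f ⊛ g) ≋ (scaleS (f 0) (divX g) ⊕ (divX f ⊛ g))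
  divX-⊛ f g n = sumTo-unconsˡ _ n

  ⊛-distribʳ : ∀ f g h → ((g ⊕ h) ⊛ f) ≋ ((g ⊛ f) ⊕ (h ⊛ f))
  ⊛-distribʳ f g h n = trans (sumTo-cong n (λ k → distribʳ _ _ _)) (sumTo-+ _ _ n)

  ⊛-scaleˡ : ∀ x f g → (scaleS x f ⊛ g) ≋ scaleS x (f ⊛ g)
  ⊛-scaleˡ x f g n = trans (sumTo-cong n (λ k → *-assoc _ _ _)) (sym (*-sumTo x _ n))

  ⊛-identityˡ : ∀ f → (oneS ⊛ f) ≋ f
  ⊛-identityˡ f zero    = *-identityˡ _
  ⊛-identityˡ f (suc n) = begin
    (oneS ⊛ f) (suc n)                    ≈⟨ divX-⊛ oneS f n ⟩
    1# * f (suc n) + (divX oneS ⊛ f) n    ≈⟨ +-cong (*-identityˡ _) (sumTo-zero n (λ k _ → zeroˡ _)) ⟩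
    f (suc n) + 0#                        ≈⟨ +-identityʳ _ ⟩
    f (suc n)                             ∎

  ⊛-comm : ∀ f g → (f ⊛ g) ≋ (g ⊛ f)
  ⊛-comm f g zero          = *-comm _ _
  ⊛-comm f g (suc zero)    = trans (+-comm _ _) (+-cong (*-comm _ _) (*-comm _ _))
  ⊛-comm f g (suc (suc n)) = begin
    (f ⊛ g) (suc (suc n))                                                   ≈⟨ divX-⊛ f g (suc n) ⟩
    f 0 * g (suc (suc n)) + (divX f ⊛ g) (suc n)                            ≈⟨ +-congˡ (⊛-comm (divX f) g (suc n)) ⟩
    f 0 * g (suc (suc n)) + (g ⊛ divX f) (suc n)                            ≈⟨ +-congˡ (divX-⊛ g (divX f) n) ⟩
    f 0 * g (suc (suc n)) + (g 0 * f (suc (suc n)) + (divX g ⊛ divX f) n)   ≈⟨ +-congˡ (+-congˡ (⊛-comm (divX g) (divX f) n)) ⟩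
    f 0 * g (suc (suc n)) + (g 0 * f (suc (suc n)) + (divX f ⊛ divX g) n)   ≈⟨ x+[y+z]≈y+[x+z] _ _ _ ⟩
    g 0 * f (suc (suc n)) + (f 0 * g (suc (suc n)) + (divX f ⊛ divX g) n)   ≈⟨ +-congˡ (divX-⊛ f (divX g) n) ⟨
    g 0 * f (suc (suc n)) + (f ⊛ divX g) (suc n)                            ≈⟨ +-congˡ (⊛-comm f (divX g) (suc n)) ⟩
    g 0 * f (suc (suc n)) + (divX g ⊛ f) (suc n)                            ≈⟨ divX-⊛ g f (suc n) ⟨
    (g ⊛ f) (suc (suc n))                                                   ∎

  ⊛-identityʳ : ∀ f → (f ⊛ oneS) ≋ f
  ⊛-identityʳ f = ≋-trans (⊛-comm f oneS) (⊛-identityˡ f)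

  ⊛-assoc : ∀ f g h → ((f ⊛ g) ⊛ h) ≋ (f ⊛ (g ⊛ h))
  ⊛-assoc f g h zero    = *-assoc _ _ _
  ⊛-assoc f g h (suc n) = begin
    ((f ⊛ g) ⊛ h) (suc n)                                                      ≈⟨ divX-⊛ (f ⊛ g) h n ⟩
    (f 0 * g 0) * h (suc n) + (divX (f ⊛ g) ⊛ h) n                             ≈⟨ +-congˡ (⊛-cong {g = h} (divX-⊛ f g) ≋-refl n) ⟩
    (f 0 * g 0) * h (suc n) + ((scaleS (f 0) (divX g) ⊕ (divX f ⊛ g)) ⊛ h) n  ≈⟨ +-congˡ (⊛-distribʳ h _ _ n) ⟩
    (f 0 * g 0) * h (suc n) + ((scaleS (f 0) (divX g) ⊛ h) n + ((divX f ⊛ g) ⊛ h) n)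
      ≈⟨ +-congˡ (+-cong (⊛-scaleˡ (f 0) (divX g) h n) (⊛-assoc (divX f) g h n)) ⟩
    (f 0 * g 0) * h (suc n) + (f 0 * (divX g ⊛ h) n + (divX f ⊛ (g ⊛ h)) n)   ≈⟨ regroup _ _ _ _ _ ⟩
    f 0 * (g 0 * h (suc n) + (divX g ⊛ h) n) + (divX f ⊛ (g ⊛ h)) n           ≈⟨ +-congʳ (*-congˡ (divX-⊛ g h n)) ⟨
    f 0 * (g ⊛ h) (suc n) + (divX f ⊛ (g ⊛ h)) n                              ≈⟨ divX-⊛ f (g ⊛ h) n ⟨
    (f ⊛ (g ⊛ h)) (suc n)                                                      ∎
    where
    regroup : ∀ f₀ g₀ x y z → (f₀ * g₀) * x + (f₀ * y + z) ≈ f₀ * (g₀ * x + y) + z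
    regroup = solve 5 (λ f₀ g₀ x y z → (f₀ :* g₀) :* x :+ (f₀ :* y :+ z) := f₀ :* (g₀ :* x :+ y) :+ z) refl
      where open Scalar

  ordinaryRing : CommutativeRing c ℓ
  ordinaryRing = seriesRing _⊛_ ⊛-cong ⊛-assoc ⊛-comm ⊛-identityˡ ⊛-distribʳ

  constS-⊛ : ∀ x f → (constS x ⊛ f) ≋ scaleS x f
  constS-⊛ x f = ≋-trans (⊛-scaleˡ x oneS f) (λ n → *-congˡ (⊛-identityˡ f n))

  constS-* : ∀ x z → constS (x * z) ≋ (constS x ⊛ constS z)
  constS-* x z = ≋-trans (λ n → *-assoc _ _ _) (≋-sym (constS-⊛ x (constS z)))

  X-⊛ : ∀ f → (X ⊛ f) ≋ mulX f
  X-⊛ f zero    = zeroˡ _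
  X-⊛ f (suc n) = trans (divX-⊛ X f n) (trans (+-cong (zeroˡ _) (⊛-identityˡ f n)) (+-identityˡ _))

  X-⊛-cancel : ∀ {f g} → (X ⊛ f) ≋ (X ⊛ g) → f ≋ g
  X-⊛-cancel {f} {g} Xf≋Xg n = trans (sym (X-⊛ f (suc n))) (trans (Xf≋Xg (suc n)) (X-⊛ g (suc n)))

  natMul-cong : ∀ n {x z} → x ≈ z → natMul n x ≈ natMul n z
  natMul-cong zero    x≈z = refl
  natMul-cong (suc n) x≈z = +-cong x≈z (natMul-cong n x≈z)

  natMul-homo-+ : ∀ m n x → natMul (m ℕ.+ n) x ≈ natMul m x + natMul n x
  natMul-homo-+ zero    n x = sym (+-identityˡ _)
  natMul-homo-+ (suc m) n x = trans (+-congˡ (natMul-homo-+ m n x)) (sym (+-assoc _ _ _))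

  natMul-distrib-+ : ∀ n x z → natMul n (x + z) ≈ natMul n x + natMul n z
  natMul-distrib-+ zero    x z = sym (+-identityˡ _)
  natMul-distrib-+ (suc n) x z = trans (+-congˡ (natMul-distrib-+ n x z)) ([w+x]+[y+z]≈[w+y]+[x+z] _ _ _ _)

  natMul-comm-* : ∀ n x z → natMul n (x * z) ≈ x * natMul n z
  natMul-comm-* zero    x z = sym (zeroʳ _)
  natMul-comm-* (suc n) x z = trans (+-congˡ (natMul-comm-* n x z)) (sym (distribˡ _ _ _))

  natMul-zero : ∀ n {x} → x ≈ 0# → natMul n x ≈ 0#
  natMul-zero zero    x≈0 = refl
  natMul-zero (suc n) x≈0 = trans (+-cong x≈0 (natMul-zero n x≈0)) (+-identityˡ 0#)

  natMul-1 : ∀ x → natMul 1 x ≈ x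
  natMul-1 = +-identityʳ

  binom-n-0 : ∀ n → binom n 0 ≡ 1
  binom-n-0 zero    = ≡.refl
  binom-n-0 (suc n) = ≡.refl

  binom-n-[1+n] : ∀ n → binom n (suc n) ≡ 0
  binom-n-[1+n] zero    = ≡.refl
  binom-n-[1+n] (suc n) = ≡.cong₂ ℕ._+_ (binom-n-[1+n] n) (binom-above n (ℕ.n≤1+n (suc n)))
    where
    binom-above : ∀ n {k} → n ℕ.< k → binom n k ≡ 0
    binom-above zero    {suc k} _         = ≡.refl
    binom-above (suc n) {suc k} (s≤s n<k) = ≡.cong₂ ℕ._+_ (binom-above n n<k) (binom-above n (ℕ.m≤n⇒m≤1+n n<k))

  ⊙-cong : ∀ {f f′ g g′} → f ≋ f′ → g ≋ g′ → (f ⊙ g) ≋ (f′ ⊙ g′)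
  ⊙-cong f≋f′ g≋g′ n = sumTo-cong n (λ k → natMul-cong (binom n k) (*-cong (f≋f′ k) (g≋g′ (n ∸ k))))

  -- The Leibniz rule: on exponential series divX is d/dt.
  divX-⊙ : ∀ f g → divX (f ⊙ g) ≋ ((divX f ⊙ g) ⊕ (f ⊙ divX g))
  divX-⊙ f g n = begin
    (f ⊙ g) (suc n)                                                  ≈⟨ sumTo-unconsˡ _ n ⟩
    t₀ + sumTo (λ k → natMul (binom n k ℕ.+ binom n (suc k)) (t k)) n
      ≈⟨ +-congˡ (trans (sumTo-cong n (λ k → natMul-homo-+ (binom n k) (binom n (suc k)) (t k))) (sumTo-+ _ _ n)) ⟩
    t₀ + ((divX f ⊙ g) n + rest)                                     ≈⟨ x+[y+z]≈y+[x+z] _ _ _ ⟩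
    (divX f ⊙ g) n + (t₀ + rest)                                     ≈⟨ +-congˡ t₀+rest≈f⊙divXg ⟩
    (divX f ⊙ g) n + (f ⊙ divX g) n                                  ∎
    where
    t : ℕ → Carrier
    t k = f (suc k) * g (n ∸ k)
    t₀ rest : Carrier
    t₀   = natMul 1 (f 0 * g (suc n))
    rest = sumTo (λ k → natMul (binom n (suc k)) (t k)) n
    s : ℕ → Carrier
    s k = natMul (binom n k) (f k * g (suc n ∸ k))
    t₀+rest≈f⊙divXg : t₀ + rest ≈ (f ⊙ divX g) n
    t₀+rest≈f⊙divXg = begin
      t₀ + rest        ≡⟨ ≡.cong (λ b → natMul b (f 0 * g (suc n)) + rest) (binom-n-0 n) ⟨
      s 0 + rest       ≈⟨ sumTo-unconsˡ s n ⟨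
      sumTo s (suc n)  ≈⟨ sumTo-init s n (reflexive (≡.cong (λ b → natMul b (f (suc n) * g (n ∸ n))) (binom-n-[1+n] n))) ⟩
      sumTo s n        ≈⟨ sumTo-cong≤ n (λ k k≤n → natMul-cong (binom n k) (*-congˡ (reflexive (≡.cong g (ℕ.+-∸-assoc 1 k≤n))))) ⟩
      (f ⊙ divX g) n   ∎

  ⊙-distribʳ : ∀ f g h → ((g ⊕ h) ⊙ f) ≋ ((g ⊙ f) ⊕ (h ⊙ f))
  ⊙-distribʳ f g h n = trans
    (sumTo-cong n (λ k → trans (natMul-cong (binom n k) (distribʳ _ _ _)) (natMul-distrib-+ (binom n k) _ _)))
    (sumTo-+ _ _ n)

  ⊙-scaleˡ : ∀ x f g → (scaleS x f ⊙ g) ≋ scaleS x (f ⊙ g)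
  ⊙-scaleˡ x f g n = trans
    (sumTo-cong n (λ k → trans (natMul-cong (binom n k) (*-assoc _ _ _)) (natMul-comm-* (binom n k) _ _)))
    (sym (*-sumTo x _ n))

  ⊙-identityˡ : ∀ f → (oneS ⊙ f) ≋ f
  ⊙-identityˡ f zero    = trans (natMul-1 _) (*-identityˡ _)
  ⊙-identityˡ f (suc n) = begin
    (oneS ⊙ f) (suc n)                       ≈⟨ divX-⊙ oneS f n ⟩
    (divX oneS ⊙ f) n + (oneS ⊙ divX f) n    ≈⟨ +-cong (sumTo-zero n (λ k _ → natMul-zero (binom n k) (zeroˡ _)))
                                                         (⊙-identityˡ (divX f) n) ⟩
    0# + f (suc n)                           ≈⟨ +-identityˡ _ ⟩
    f (suc n)                                ∎

  ⊙-comm : ∀ f g → (f ⊙ g) ≋ (g ⊙ f)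
  ⊙-comm f g zero    = natMul-cong 1 (*-comm _ _)
  ⊙-comm f g (suc n) = begin
    (f ⊙ g) (suc n)                    ≈⟨ divX-⊙ f g n ⟩
    (divX f ⊙ g) n + (f ⊙ divX g) n    ≈⟨ +-cong (⊙-comm (divX f) g n) (⊙-comm f (divX g) n) ⟩
    (g ⊙ divX f) n + (divX g ⊙ f) n    ≈⟨ +-comm _ _ ⟩
    (divX g ⊙ f) n + (g ⊙ divX f) n    ≈⟨ divX-⊙ g f n ⟨
    (g ⊙ f) (suc n)                    ∎

  ⊙-distribˡ : ∀ f g h → (f ⊙ (g ⊕ h)) ≋ ((f ⊙ g) ⊕ (f ⊙ h))
  ⊙-distribˡ f g h n = trans (⊙-comm f (g ⊕ h) n) (trans (⊙-distribʳ f g h n) (+-cong (⊙-comm g f n) (⊙-comm h f n)))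

  ⊙-assoc : ∀ f g h → ((f ⊙ g) ⊙ h) ≋ (f ⊙ (g ⊙ h))
  ⊙-assoc f g h zero    = trans (natMul-1 _) (trans (*-congʳ (natMul-1 _))
    (trans (*-assoc _ _ _) (trans (*-congˡ (sym (natMul-1 _))) (sym (natMul-1 _)))))
  ⊙-assoc f g h (suc n) = begin
    ((f ⊙ g) ⊙ h) (suc n)                                                      ≈⟨ divX-⊙ (f ⊙ g) h n ⟩
    (divX (f ⊙ g) ⊙ h) n + ((f ⊙ g) ⊙ divX h) n                               ≈⟨ +-congʳ (⊙-cong {g = h} (divX-⊙ f g) ≋-refl n) ⟩
    (((divX f ⊙ g) ⊕ (f ⊙ divX g)) ⊙ h) n + ((f ⊙ g) ⊙ divX h) n              ≈⟨ +-congʳ (⊙-distribʳ h _ _ n) ⟩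
    (((divX f ⊙ g) ⊙ h) n + ((f ⊙ divX g) ⊙ h) n) + ((f ⊙ g) ⊙ divX h) n
      ≈⟨ +-cong (+-cong (⊙-assoc (divX f) g h n) (⊙-assoc f (divX g) h n)) (⊙-assoc f g (divX h) n) ⟩
    ((divX f ⊙ (g ⊙ h)) n + (f ⊙ (divX g ⊙ h)) n) + (f ⊙ (g ⊙ divX h)) n      ≈⟨ +-assoc _ _ _ ⟩
    (divX f ⊙ (g ⊙ h)) n + ((f ⊙ (divX g ⊙ h)) n + (f ⊙ (g ⊙ divX h)) n)      ≈⟨ +-congˡ (⊙-distribˡ f (divX g ⊙ h) (g ⊙ divX h) n) ⟨
    (divX f ⊙ (g ⊙ h)) n + (f ⊙ ((divX g ⊙ h) ⊕ (g ⊙ divX h))) n              ≈⟨ +-congˡ (⊙-cong {f = f} ≋-refl (divX-⊙ g h) n) ⟨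
    (divX f ⊙ (g ⊙ h)) n + (f ⊙ divX (g ⊙ h)) n                               ≈⟨ divX-⊙ f (g ⊙ h) n ⟨
    (f ⊙ (g ⊙ h)) (suc n)                                                      ∎

  exponentialRing : CommutativeRing c ℓ
  exponentialRing = seriesRing _⊙_ ⊙-cong ⊙-assoc ⊙-comm ⊙-identityˡ ⊙-distribʳ

  constS-⊙ : ∀ x f → (constS x ⊙ f) ≋ scaleS x f
  constS-⊙ x f = ≋-trans (⊙-scaleˡ x oneS f) (λ n → *-congˡ (⊙-identityˡ f n))

  expS-cong : ∀ {r r′} → r ≈ r′ → expS r ≋ expS r′
  expS-cong r≈r′ zero    = refl
  expS-cong r≈r′ (suc n) = *-cong r≈r′ (expS-cong r≈r′ n)

  expS-0 : expS 0# ≋ oneS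
  expS-0 zero    = refl
  expS-0 (suc n) = zeroˡ _

  expS-+ : ∀ r s → (expS r ⊙ expS s) ≋ expS (r + s)
  expS-+ r s zero    = trans (natMul-1 _) (*-identityˡ _)
  expS-+ r s (suc n) = begin
    (expS r ⊙ expS s) (suc n)                                           ≈⟨ divX-⊙ (expS r) (expS s) n ⟩
    (scaleS r (expS r) ⊙ expS s) n + (expS r ⊙ scaleS s (expS s)) n     ≈⟨ +-cong (⊙-scaleˡ r (expS r) (expS s) n) scaleʳ ⟩
    r * (expS r ⊙ expS s) n + s * (expS r ⊙ expS s) n                   ≈⟨ distribʳ _ _ _ ⟨
    (r + s) * (expS r ⊙ expS s) n                                       ≈⟨ *-congˡ (expS-+ r s n) ⟩
    expS (r + s) (suc n)                                                ∎
    where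
    scaleʳ : (expS r ⊙ scaleS s (expS s)) n ≈ s * (expS r ⊙ expS s) n
    scaleʳ = trans (⊙-comm _ _ n) (trans (⊙-scaleˡ s (expS s) (expS r) n) (*-congˡ (⊙-comm _ _ n)))

  private
    cancel-inverse : ∀ {f₀ c} S → f₀ * c ≈ 1# → f₀ * (- (c * S)) + S ≈ 0#
    cancel-inverse {f₀} {c} S f₀c≈1 = begin
      f₀ * (- (c * S)) + S    ≈⟨ regroup f₀ c S ⟩
      S - (f₀ * c) * S        ≈⟨ +-congˡ (-‿cong (trans (*-congʳ f₀c≈1) (*-identityˡ S))) ⟩
      S - S                   ≈⟨ -‿inverseʳ S ⟩
      0#                      ∎
      where
      regroup : ∀ f₀ c S → f₀ * (- (c * S)) + S ≈ S - (f₀ * c) * S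
      regroup = solve 3 (λ f₀ c S → f₀ :* (:- (c :* S)) :+ S := S :- (f₀ :* c) :* S) refl
        where open Scalar

  ogfInvAux-fuel : ∀ c f {m m′} n → n ℕ.< m → n ℕ.< m′ → ogfInvAux c f m n ≈ ogfInvAux c f m′ n
  ogfInvAux-fuel c f {suc m} {suc m′} zero    _         _          = refl
  ogfInvAux-fuel c f {suc m} {suc m′} (suc n) (s≤s n<m) (s≤s n<m′) =
    -‿cong (*-congˡ (sumTo-cong≤ n (λ k k≤n → *-congˡ (ogfInvAux-fuel c f (n ∸ k)
      (ℕ.≤-<-trans (ℕ.m∸n≤m n k) n<m) (ℕ.≤-<-trans (ℕ.m∸n≤m n k) n<m′)))))

  ogfInv-inverse : ∀ c f → f 0 * c ≈ 1# → (f ⊛ ogfInv c f) ≋ oneS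
  ogfInv-inverse c f f₀c≈1 zero    = f₀c≈1
  ogfInv-inverse c f f₀c≈1 (suc n) = begin
    (f ⊛ ogfInv c f) (suc n)                                         ≈⟨ divX-⊛ f (ogfInv c f) n ⟩
    f 0 * ogfInv c f (suc n) + sumTo (λ k → f (suc k) * ogfInv c f (n ∸ k)) n
      ≈⟨ +-congˡ (sumTo-cong≤ n (λ k k≤n → *-congˡ (ogfInvAux-fuel c f (n ∸ k) ℕ.≤-refl (s≤s (ℕ.m∸n≤m n k))))) ⟩
    f 0 * (- (c * S)) + S                                            ≈⟨ cancel-inverse S f₀c≈1 ⟩
    0#                                                               ∎
    where
    S = sumTo (λ k → f (suc k) * ogfInvAux c f (suc n) (n ∸ k)) n

  egfInvAux-fuel : ∀ c f {m m′} n → n ℕ.< m → n ℕ.< m′ → egfInvAux c f m n ≈ egfInvAux c f m′ n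
  egfInvAux-fuel c f {suc m} {suc m′} zero    _         _          = refl
  egfInvAux-fuel c f {suc m} {suc m′} (suc n) (s≤s n<m) (s≤s n<m′) =
    -‿cong (*-congˡ (sumTo-cong≤ n (λ k k≤n → natMul-cong (binom (suc n) (suc k)) (*-congˡ (egfInvAux-fuel c f (n ∸ k)
      (ℕ.≤-<-trans (ℕ.m∸n≤m n k) n<m) (ℕ.≤-<-trans (ℕ.m∸n≤m n k) n<m′))))))

  egfInv-inverse : ∀ c f → f 0 * c ≈ 1# → (f ⊙ egfInv c f) ≋ oneS
  egfInv-inverse c f f₀c≈1 zero    = trans (natMul-1 _) f₀c≈1
  egfInv-inverse c f f₀c≈1 (suc n) = begin
    (f ⊙ egfInv c f) (suc n)                                         ≈⟨ sumTo-unconsˡ _ n ⟩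
    natMul 1 (f 0 * egfInv c f (suc n))
      + sumTo (λ k → natMul (binom (suc n) (suc k)) (f (suc k) * egfInv c f (n ∸ k))) n
      ≈⟨ +-cong (natMul-1 _) (sumTo-cong≤ n (λ k k≤n → natMul-cong (binom (suc n) (suc k))
           (*-congˡ (egfInvAux-fuel c f (n ∸ k) ℕ.≤-refl (s≤s (ℕ.m∸n≤m n k)))))) ⟩
    f 0 * (- (c * S)) + S                                            ≈⟨ cancel-inverse S f₀c≈1 ⟩
    0#                                                               ∎
    where
    S = sumTo (λ k → natMul (binom (suc n) (suc k)) (f (suc k) * egfInvAux c f (suc n) (n ∸ k))) n

  -- f(h(x)); truncating the sum at k = n is faithful only when h 0 ≈ 0, which every use assumes.
  comp : Series → Series → Series
  comp f h n = sumTo (λ k → f k * powS h k n) n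

  comp-cong : ∀ {f f′} h → f ≋ f′ → comp f h ≋ comp f′ h
  comp-cong h f≋f′ n = sumTo-cong n (λ k → *-congʳ (f≋f′ k))

  comp-⊕ : ∀ f g h → comp (f ⊕ g) h ≋ (comp f h ⊕ comp g h)
  comp-⊕ f g h n = trans (sumTo-cong n (λ k → distribʳ _ _ _)) (sumTo-+ _ _ n)

  comp-scale : ∀ x f h → comp (scaleS x f) h ≋ scaleS x (comp f h)
  comp-scale x f h n = trans (sumTo-cong n (λ k → *-assoc _ _ _)) (sym (*-sumTo x _ n))

  comp-neg : ∀ f h → comp (negS f) h ≋ negS (comp f h)
  comp-neg f h n = trans (sumTo-cong n (λ k → sym (-‿distribˡ-* _ _))) (sym (-‿sumTo _ n))

  comp-one : ∀ h → comp oneS h ≋ oneS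
  comp-one h zero    = *-identityˡ _
  comp-one h (suc n) = trans (sumTo-unconsˡ _ n) (trans (+-cong (zeroʳ _) (sumTo-zero n (λ k _ → zeroˡ _))) (+-identityˡ _))

  comp-const : ∀ x h → comp (constS x) h ≋ constS x
  comp-const x h = ≋-trans (comp-scale x oneS h) (λ n → *-congˡ (comp-one h n))

  module Composition (h : Series) (h₀≈0 : h 0 ≈ 0#) where

    private
      h₀*x≈0 : ∀ x → h 0 * x ≈ 0#
      h₀*x≈0 x = 0*x≈0 x h₀≈0

    powS-below : ∀ k m → m ℕ.< k → powS h k m ≈ 0#
    powS-below (suc k) zero    _         = h₀*x≈0 _
    powS-below (suc k) (suc m) (s≤s m<k) = begin
      (h ⊛ powS h k) (suc m)                                ≈⟨ divX-⊛ h (powS h k) m ⟩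
      h 0 * powS h k (suc m) + (divX h ⊛ powS h k) m        ≈⟨ +-cong (h₀*x≈0 _) (sumTo-zero m (λ j _ →
                                                                 x*0≈0 _ (powS-below k (m ∸ j) (ℕ.≤-<-trans (ℕ.m∸n≤m m j) m<k)))) ⟩
      0# + 0#                                               ≈⟨ +-identityˡ _ ⟩
      0#                                                    ∎

    ⊛-cong-below : ∀ {V V′} n → (∀ k → k ℕ.< n → V k ≈ V′ k) → (h ⊛ V) n ≈ (h ⊛ V′) n
    ⊛-cong-below zero    _     = trans (h₀*x≈0 _) (sym (h₀*x≈0 _))
    ⊛-cong-below {V} {V′} (suc n) V≈V′ = begin
      (h ⊛ V) (suc n)                        ≈⟨ divX-⊛ h V n ⟩
      h 0 * V (suc n) + (divX h ⊛ V) n       ≈⟨ +-cong (trans (h₀*x≈0 _) (sym (h₀*x≈0 _)))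
                                                        (⊛-cong≤ n (λ _ _ → refl) (λ k k≤n → V≈V′ k (s≤s k≤n))) ⟩
      h 0 * V′ (suc n) + (divX h ⊛ V′) n     ≈⟨ divX-⊛ h V′ n ⟨
      (h ⊛ V′) (suc n)                       ∎

    ⊛-comp : ∀ g f n → (g ⊛ comp f h) n ≈ sumTo (λ k → f k * (g ⊛ powS h k) n) n
    ⊛-comp g f n = begin
      sumTo (λ j → g j * sumTo (λ k → f k * powS h k (n ∸ j)) (n ∸ j)) n
        ≈⟨ sumTo-cong≤ n (λ j _ → *-congˡ (sumTo-extend _ (ℕ.m∸n≤m n j)
             (λ k n∸j<k _ → x*0≈0 _ (powS-below k (n ∸ j) n∸j<k)))) ⟩
      sumTo (λ j → g j * sumTo (λ k → f k * powS h k (n ∸ j)) n) n      ≈⟨ sumTo-cong n (λ j → *-sumTo (g j) _ n) ⟩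
      sumTo (λ j → sumTo (λ k → g j * (f k * powS h k (n ∸ j))) n) n    ≈⟨ sumTo-comm _ n n ⟩
      sumTo (λ k → sumTo (λ j → g j * (f k * powS h k (n ∸ j))) n) n
        ≈⟨ sumTo-cong n (λ k → trans (sumTo-cong n (λ j → x*[y*z]≈y*[x*z] _ _ _)) (sym (*-sumTo (f k) _ n))) ⟩
      sumTo (λ k → f k * (g ⊛ powS h k) n) n                            ∎
      where
      x*[y*z]≈y*[x*z] : ∀ x y z → x * (y * z) ≈ y * (x * z)
      x*[y*z]≈y*[x*z] x y z = trans (sym (*-assoc x y z)) (trans (*-congʳ (*-comm x y)) (*-assoc y x z))

    comp-horner : ∀ f → comp f h ≋ (constS (f 0) ⊕ (h ⊛ comp (divX f) h))
    comp-horner f zero    = sym (trans (+-congˡ (h₀*x≈0 _)) (+-identityʳ _))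
    comp-horner f (suc n) = begin
      comp f h (suc n)                                                                ≈⟨ sumTo-unconsˡ _ n ⟩
      f 0 * oneS (suc n) + sumTo (λ k → f (suc k) * powS h (suc k) (suc n)) n         ≈⟨ +-congˡ (sumTo-init _ n
                                                                                           (x*0≈0 _ (powS-below _ _ (ℕ.n<1+n (suc n))))) ⟨
      f 0 * oneS (suc n) + sumTo (λ k → f (suc k) * powS h (suc k) (suc n)) (suc n)   ≈⟨ +-congˡ (⊛-comp h (divX f) (suc n)) ⟨
      f 0 * oneS (suc n) + (h ⊛ comp (divX f) h) (suc n)                              ∎

  powS-cong-below : ∀ {f g} N → (∀ i → i ℕ.< N → f i ≈ g i) → ∀ k i → i ℕ.< N → powS f k i ≈ powS g k i
  powS-cong-below N f≈g zero    i i<N = refl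
  powS-cong-below N f≈g (suc k) i i<N =
    ⊛-cong≤ i (λ j j≤i → f≈g j (ℕ.≤-<-trans j≤i i<N)) (λ j j≤i → powS-cong-below N f≈g k j (ℕ.≤-<-trans j≤i i<N))

  ⊛-cong-interior : ∀ {f g F G} N → f 0 ≈ 0# → g 0 ≈ 0# → F 0 ≈ 0# → G 0 ≈ 0# →
    (∀ i → i ℕ.< N → f i ≈ g i) → (∀ i → i ℕ.< N → F i ≈ G i) → (f ⊛ F) N ≈ (g ⊛ G) N
  ⊛-cong-interior {f} {g} {F} {G} N f₀≈0 g₀≈0 F₀≈0 G₀≈0 f≈g F≈G = sumTo-cong≤ N term
    where
    term : ∀ k → k ℕ.≤ N → f k * F (N ∸ k) ≈ g k * G (N ∸ k)
    term zero    _ = trans (0*x≈0 _ f₀≈0) (sym (0*x≈0 _ g₀≈0))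
    term (suc j) 1+j≤N with ℕ.m≤n⇒m<n∨m≡n 1+j≤N
    ... | inj₁ 1+j<N  = *-cong (f≈g _ 1+j<N) (F≈G _ (ℕ.∸-monoʳ-< (s≤s z≤n) 1+j≤N))
    ... | inj₂ ≡.refl = trans (x*0≈0 _ (vanish F F₀≈0)) (sym (x*0≈0 _ (vanish G G₀≈0)))
      where
      vanish : ∀ H → H 0 ≈ 0# → H (suc j ∸ suc j) ≈ 0#
      vanish H H₀≈0 = trans (reflexive (≡.cong H (ℕ.n∸n≡0 j))) H₀≈0

  powS-cong-top : ∀ {f g} N → f 0 ≈ 0# → g 0 ≈ 0# → (∀ i → i ℕ.< N → f i ≈ g i) →
    ∀ k → powS f (suc (suc k)) N ≈ powS g (suc (suc k)) N
  powS-cong-top N f₀≈0 g₀≈0 f≈g k =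
    ⊛-cong-interior N f₀≈0 g₀≈0 (0*x≈0 _ f₀≈0) (0*x≈0 _ g₀≈0) f≈g (powS-cong-below N f≈g (suc k))

  revAux-fuel : ∀ c F {m} n → n ℕ.< m → revAux c F m n ≈ Rev c F n
  revAux-fuel c F n = <-rec P step n
    where
    P : ℕ → Set ℓ
    P n = ∀ {m} → n ℕ.< m → revAux c F m n ≈ Rev c F n
    step : ∀ n → (∀ {i} → i ℕ.< n → P i) → P n
    step zero                IH {suc m} _ = refl
    step (suc zero)          IH {suc m} _ = refl
    step (suc (suc n)) IH {suc (suc m)} (s≤s n+2<m+1) =
      -‿cong (*-congˡ (sumTo-cong n (λ k → *-congˡ (powS-cong-top (suc (suc n)) refl refl agree k))))
      where
      agree : ∀ i → i ℕ.< suc (suc n) → revAux c F (suc m) i ≈ revAux c F (suc (suc n)) i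
      agree i i<n+2 = trans (IH i<n+2 (ℕ.<-≤-trans i<n+2 n+2<m+1)) (sym (IH i<n+2 i<n+2))

  Rev-inverse : ∀ F → F 0 ≈ 0# → F 1 ≈ 1# → comp F (Rev 1# F) ≋ X
  Rev-inverse F F₀≈0 F₁≈1 zero          = 0*x≈0 _ F₀≈0
  Rev-inverse F F₀≈0 F₁≈1 (suc zero)    =
    trans (+-cong (x*0≈0 _ refl) (trans (*-cong F₁≈1 (⊛-identityʳ (Rev 1# F) 1)) (*-identityˡ _))) (+-identityˡ _)
  Rev-inverse F F₀≈0 F₁≈1 (suc (suc n)) = begin
    comp F Rv (suc (suc n))                                        ≈⟨ sumTo-unconsˡ _ (suc n) ⟩
    F 0 * oneS (suc (suc n)) + sumTo (λ k → F (suc k) * powS Rv (suc k) (suc (suc n))) (suc n)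
                                                                   ≈⟨ +-cong (x*0≈0 _ refl) (sumTo-unconsˡ _ n) ⟩
    0# + (F 1 * powS Rv 1 (suc (suc n)) + higher Rv)               ≈⟨ +-identityˡ _ ⟩
    F 1 * powS Rv 1 (suc (suc n)) + higher Rv
      ≈⟨ +-cong (trans (*-cong F₁≈1 (⊛-identityʳ Rv (suc (suc n)))) (*-identityˡ _))
                (sumTo-cong n (λ k → *-congˡ (powS-cong-top (suc (suc n)) refl refl agree k))) ⟩
    - (1# * higher Rv′) + higher Rv′                               ≈⟨ +-congʳ (-‿cong (*-identityˡ _)) ⟩
    - higher Rv′ + higher Rv′                                      ≈⟨ -‿inverseˡ _ ⟩
    0#                                                             ∎
    where
    Rv Rv′ : Series
    Rv  = Rev 1# F
    Rv′ = revAux 1# F (suc (suc n))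
    higher : Series → Carrier
    higher V = sumTo (λ k → F (suc (suc k)) * powS V (suc (suc k)) (suc (suc n))) n
    agree : ∀ i → i ℕ.< suc (suc n) → Rv i ≈ Rv′ i
    agree i i<n+2 = sym (revAux-fuel 1# F i i<n+2)

  ⊛-fixedPoint-zero : ∀ {h D} → h 0 ≈ 0# → D ≋ (h ⊛ D) → D ≋ zeroS
  ⊛-fixedPoint-zero {h} {D} h₀≈0 D≋hD = <-rec (λ n → D n ≈ 0#) step
    where
    step : ∀ n → (∀ {m} → m ℕ.< n → D m ≈ 0#) → D n ≈ 0#
    step zero    _  = trans (D≋hD 0) (0*x≈0 _ h₀≈0)
    step (suc n) IH = begin
      D (suc n)                            ≈⟨ trans (D≋hD (suc n)) (divX-⊛ h D n) ⟩
      h 0 * D (suc n) + (divX h ⊛ D) n     ≈⟨ +-cong (0*x≈0 _ h₀≈0) (sumTo-zero n (λ j _ → x*0≈0 _ (IH (s≤s (ℕ.m∸n≤m n j))))) ⟩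
      0# + 0#                              ≈⟨ +-identityˡ 0# ⟩
      0#                                   ∎

  powS-diagonal : ∀ f → f 0 ≈ 0# → ∀ k → powS f k k ≈ pow (f 1) k
  powS-diagonal f f₀≈0 zero    = refl
  powS-diagonal f f₀≈0 (suc k) = begin
    (f ⊛ powS f k) (suc k)                           ≈⟨ divX-⊛ f (powS f k) k ⟩
    f 0 * powS f k (suc k) + (divX f ⊛ powS f k) k   ≈⟨ +-cong (0*x≈0 _ f₀≈0) (leading k) ⟩
    0# + f 1 * powS f k k                            ≈⟨ +-identityˡ _ ⟩
    f 1 * powS f k k                                 ≈⟨ *-congˡ (powS-diagonal f f₀≈0 k) ⟩
    pow (f 1) (suc k)                                ∎
    where
    open Composition f f₀≈0 using (powS-below)
    leading : ∀ k → (divX f ⊛ powS f k) k ≈ f 1 * powS f k k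
    leading zero    = refl
    leading (suc k) = trans (sumTo-unconsˡ _ k) (trans (+-congˡ (sumTo-zero k (λ j _ →
      x*0≈0 _ (powS-below (suc k) (k ∸ j) (s≤s (ℕ.m∸n≤m k j)))))) (+-identityʳ _))

  riordan-diagonal : ∀ G F → G 0 ≈ 1# → F 0 ≈ 0# → F 1 ≈ 1# → ∀ n → riordan G F n n ≈ 1#
  riordan-diagonal G F G₀≈1 F₀≈0 F₁≈1 zero    = trans (*-identityʳ _) G₀≈1
  riordan-diagonal G F G₀≈1 F₀≈0 F₁≈1 (suc n) = begin
    (G ⊛ powS F (suc n)) (suc n)                                    ≈⟨ divX-⊛ G (powS F (suc n)) n ⟩
    G 0 * powS F (suc n) (suc n) + (divX G ⊛ powS F (suc n)) n      ≈⟨ +-cong (*-cong G₀≈1 Fⁿ⁺¹ₙ₊₁≈1) below-diagonal ⟩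
    1# * 1# + 0#                                                    ≈⟨ trans (+-identityʳ _) (*-identityˡ _) ⟩
    1#                                                              ∎
    where
    open Composition F F₀≈0 using (powS-below)
    pow-1 : ∀ n → pow 1# n ≈ 1#
    pow-1 zero    = refl
    pow-1 (suc n) = trans (*-identityˡ _) (pow-1 n)
    Fⁿ⁺¹ₙ₊₁≈1 : powS F (suc n) (suc n) ≈ 1#
    Fⁿ⁺¹ₙ₊₁≈1 = trans (powS-diagonal F F₀≈0 (suc n)) (trans (expS-cong F₁≈1 (suc n)) (pow-1 (suc n)))
    below-diagonal : (divX G ⊛ powS F (suc n)) n ≈ 0#
    below-diagonal = sumTo-zero n (λ j _ → x*0≈0 _ (powS-below (suc n) (n ∸ j) (s≤s (ℕ.m∸n≤m n j))))

  riordan-action : ∀ G F T → F 0 ≈ 0# → ∀ n → sumTo (λ j → riordan G F n j * T j) n ≈ (G ⊛ comp T F) n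
  riordan-action G F T F₀≈0 n =
    trans (sumTo-cong n (λ j → *-comm _ _)) (sym (Composition.⊛-comp F F₀≈0 G T n))

  uniInvAux-fuel : ∀ M {m m′} j → j ℕ.< m → j ℕ.< m′ → uniInvAux M m j 0 ≈ uniInvAux M m′ j 0
  uniInvAux-fuel M {suc m} {suc m′} zero    _         _          = refl
  uniInvAux-fuel M {suc m} {suc m′} (suc j) (s≤s j<m) (s≤s j<m′) = -‿cong (sumTo-cong≤ j (λ i i≤j →
    *-congˡ (uniInvAux-fuel M i (ℕ.<-≤-trans (s≤s i≤j) j<m) (ℕ.<-≤-trans (s≤s i≤j) j<m′))))

  moments-unique : ∀ M T → (∀ n → M n n ≈ 1#) → (∀ n → sumTo (λ j → M n j * T j) n ≈ oneS n) → T ≋ moments M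
  moments-unique M T Mₙₙ≈1 MT≈e₀ = <-rec (λ n → T n ≈ moments M n) step
    where
    step : ∀ n → (∀ {m} → m ℕ.< n → T m ≈ moments M m) → T n ≈ moments M n
    step zero    _  = trans (sym (*-identityˡ _)) (trans (*-congʳ (sym (Mₙₙ≈1 0))) (MT≈e₀ 0))
    step (suc n) IH = begin
      T (suc n)                                 ≈⟨ isolate S (T (suc n)) ⟩
      - S + (S + T (suc n))                     ≈⟨ +-congˡ (+-congˡ (trans (sym (*-identityˡ _)) (*-congʳ (sym (Mₙₙ≈1 (suc n)))))) ⟩
      - S + (S + M (suc n) (suc n) * T (suc n)) ≈⟨ +-congˡ (MT≈e₀ (suc n)) ⟩
      - S + 0#                                  ≈⟨ +-identityʳ _ ⟩
      - S                                       ≈⟨ -‿cong (sumTo-cong≤ n (λ j j≤n → *-congˡ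
                                                     (trans (IH (s≤s j≤n)) (uniInvAux-fuel M j ℕ.≤-refl (s≤s j≤n))))) ⟩
      moments M (suc n)                         ∎
      where
      S = sumTo (λ j → M (suc n) j * T j) n
      isolate : ∀ x z → z ≈ - x + (x + z)
      isolate = solve 2 (λ x z → z := :- x :+ (x :+ z)) refl
        where open Scalar

module SeriesAlgebra {c ℓ} (R : CommutativeRing c ℓ) where
  open CommutativeRing R
  open PowerSeries R
  open FormalSeries R
  open import Algebra.Properties.Ring ring using (-0#≈0#)
  open SetoidReasoning ≋-setoid
  private
    module Scalar   = IntegerCoefficients R
    module Ordinary = IntegerCoefficients ordinaryRing

  module Substitution (h : Series) (h₀≈0 : h 0 ≈ 0#) where
    open Composition h h₀≈0

    comp-X : comp X h ≋ h
    comp-X = begin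
      comp X h                            ≈⟨ comp-horner X ⟩
      constS 0# ⊕ (h ⊛ comp oneS h)       ≈⟨ ⊕-cong (λ _ → zeroˡ _) (⊛-cong {f = h} ≋-refl (comp-one h)) ⟩
      zeroS ⊕ (h ⊛ oneS)                  ≈⟨ (λ n → trans (+-identityˡ _) (⊛-identityʳ h n)) ⟩
      h                                   ∎

    comp-⊛ : ∀ f g → comp (f ⊛ g) h ≋ (comp f h ⊛ comp g h)
    comp-⊛ f g n = <-rec P step n f g
      where
      P : ℕ → Set (c ⊔ ℓ)
      P n = ∀ f g → comp (f ⊛ g) h n ≈ (comp f h ⊛ comp g h) n
      step : ∀ n → (∀ {m} → m ℕ.< n → P m) → P n
      step n IH f g = trans (comp-horner (f ⊛ g) n) (trans (+-congˡ (⊛-cong-below n divX-part)) (expand n))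
        where
        f₀ g₀ A B : Series
        f₀ = constS (f 0)
        g₀ = constS (g 0)
        A  = comp (divX f) h
        B  = comp (divX g) h
        divX-part : ∀ k → k ℕ.< n → comp (divX (f ⊛ g)) h k ≈ (scaleS (f 0) B ⊕ (A ⊛ comp g h)) k
        divX-part k k<n = trans (comp-cong h (divX-⊛ f g) k)
          (trans (comp-⊕ _ _ h k) (+-cong (comp-scale (f 0) (divX g) h k) (IH k<n (divX f) g)))
        expand : (constS (f 0 * g 0) ⊕ (h ⊛ (scaleS (f 0) B ⊕ (A ⊛ comp g h)))) ≋ (comp f h ⊛ comp g h)
        expand = begin
          constS (f 0 * g 0) ⊕ (h ⊛ (scaleS (f 0) B ⊕ (A ⊛ comp g h)))
            ≈⟨ ⊕-cong (constS-* (f 0) (g 0))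
                      (⊛-cong {f = h} ≋-refl (⊕-cong (≋-sym (constS-⊛ (f 0) B)) (⊛-cong {f = A} ≋-refl (comp-horner g)))) ⟩
          (f₀ ⊛ g₀) ⊕ (h ⊛ ((f₀ ⊛ B) ⊕ (A ⊛ (g₀ ⊕ (h ⊛ B)))))    ≈⟨ factor f₀ g₀ h A B ⟩
          (f₀ ⊕ (h ⊛ A)) ⊛ (g₀ ⊕ (h ⊛ B))                        ≈⟨ ⊛-cong (comp-horner f) (comp-horner g) ⟨
          comp f h ⊛ comp g h                                     ∎
          where
          factor : ∀ F₀ G₀ H A B →
            ((F₀ ⊛ G₀) ⊕ (H ⊛ ((F₀ ⊛ B) ⊕ (A ⊛ (G₀ ⊕ (H ⊛ B)))))) ≋ ((F₀ ⊕ (H ⊛ A)) ⊛ (G₀ ⊕ (H ⊛ B)))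
          factor = solve 5 (λ F₀ G₀ H A B → (F₀ :* G₀) :+ (H :* ((F₀ :* B) :+ (A :* (G₀ :+ (H :* B)))))
                                            := (F₀ :+ (H :* A)) :* (G₀ :+ (H :* B))) ≋-refl
            where open Ordinary

    comp-geometric : ∀ r → (comp (expS r) h ⊛ (oneS ⊕ negS (constS r ⊛ h))) ≋ oneS
    comp-geometric r = begin
      e ⊛ (oneS ⊕ negS (constS r ⊛ h))                       ≈⟨ expand e (constS r) h ⟩
      e ⊕ negS (h ⊛ (constS r ⊛ e))                          ≈⟨ ⊕-cong e≋1+hre ≋-refl ⟩
      (oneS ⊕ (h ⊛ (constS r ⊛ e))) ⊕ negS (h ⊛ (constS r ⊛ e)) ≈⟨ cancel _ ⟩
      oneS                                                    ∎
      where
      e = comp (expS r) h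
      e≋1+hre : e ≋ (oneS ⊕ (h ⊛ (constS r ⊛ e)))
      e≋1+hre = ≋-trans (comp-horner (expS r))
        (⊕-cong constS-1 (⊛-cong {f = h} ≋-refl (≋-trans (comp-scale r (expS r) h) (≋-sym (constS-⊛ r e)))))
      open Ordinary
      expand : ∀ A C H → (A ⊛ (oneS ⊕ negS (C ⊛ H))) ≋ (A ⊕ negS (H ⊛ (C ⊛ A)))
      expand = solve 3 (λ A C H → A :* (con (+ 1) :- (C :* H)) := A :- (H :* (C :* A))) ≋-refl
      cancel : ∀ V → ((oneS ⊕ V) ⊕ negS V) ≋ oneS
      cancel = solve 1 (λ V → (con (+ 1) :+ V) :- V := con (+ 1)) ≋-refl

  linearFactor : Carrier → Series → Series → Series
  linearFactor r H V = oneS ⊕ negS (constS r ⊛ (H ⊛ V))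

  -- For H = x this is the functional equation of the moment series.
  Quadratic : Carrier → Carrier → Carrier → Series → Series → Set ℓ
  Quadratic β p q H V = (V ⊛ linearFactor β H V) ≋ (linearFactor p H V ⊛ linearFactor q H V)

  -- V − V′ = (H S)(V − V′) for an explicit series S, and such a fixed point vanishes.
  quadratic-unique : ∀ {β p q H V V′} → H 0 ≈ 0# → Quadratic β p q H V → Quadratic β p q H V′ → V ≋ V′
  quadratic-unique {β} {p} {q} {H} {V} {V′} H₀≈0 quadV quadV′ n =
    trans (isolate (V n) (V′ n)) (trans (+-congʳ (⊛-fixedPoint-zero (0*x≈0 _ H₀≈0) D≋HSD n)) (+-identityˡ _))
    where
    D S : Series
    D = V ⊕ negS V′
    S = ((constS β ⊛ (V ⊕ V′)) ⊕ negS (constS p ⊕ constS q)) ⊕ ((constS p ⊛ constS q) ⊛ (H ⊛ (V ⊕ V′)))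
    isolate : ∀ x z → x ≈ (x - z) + z
    isolate = solve 2 (λ x z → x := (x :- z) :+ z) refl
      where open Scalar
    difference : ∀ V V′ H B P Q →
      ((V ⊕ negS V′) ⊕ negS (H ⊛ ((((B ⊛ (V ⊕ V′)) ⊕ negS (P ⊕ Q)) ⊕ ((P ⊛ Q) ⊛ (H ⊛ (V ⊕ V′)))) ⊛ (V ⊕ negS V′))))
      ≋ (((V ⊛ (oneS ⊕ negS (B ⊛ (H ⊛ V)))) ⊕ negS ((oneS ⊕ negS (P ⊛ (H ⊛ V))) ⊛ (oneS ⊕ negS (Q ⊛ (H ⊛ V)))))
         ⊕ negS ((V′ ⊛ (oneS ⊕ negS (B ⊛ (H ⊛ V′)))) ⊕ negS ((oneS ⊕ negS (P ⊛ (H ⊛ V′))) ⊛ (oneS ⊕ negS (Q ⊛ (H ⊛ V′))))))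
    difference = solve 6 (λ V V′ H B P Q →
      (V :- V′) :- (H :* ((((B :* (V :+ V′)) :- (P :+ Q)) :+ ((P :* Q) :* (H :* (V :+ V′)))) :* (V :- V′)))
      := ((V :* (con (+ 1) :- (B :* (H :* V)))) :- ((con (+ 1) :- (P :* (H :* V))) :* (con (+ 1) :- (Q :* (H :* V)))))
         :- ((V′ :* (con (+ 1) :- (B :* (H :* V′)))) :- ((con (+ 1) :- (P :* (H :* V′))) :* (con (+ 1) :- (Q :* (H :* V′))))))
      ≋-refl
      where open Ordinary
    D≋HSD : D ≋ ((H ⊛ S) ⊛ D)
    D≋HSD = begin
      D                                                  ≈⟨ (λ n → isolate (D n) ((H ⊛ (S ⊛ D)) n)) ⟩
      (D ⊕ negS (H ⊛ (S ⊛ D))) ⊕ (H ⊛ (S ⊛ D))           ≈⟨ ⊕-cong (difference V V′ H (constS β) (constS p) (constS q)) ≋-refl ⟩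
      ((V ⊛ linearFactor β H V) ⊕ negS (linearFactor p H V ⊛ linearFactor q H V))
        ⊕ negS ((V′ ⊛ linearFactor β H V′) ⊕ negS (linearFactor p H V′ ⊛ linearFactor q H V′)) ⊕ (H ⊛ (S ⊛ D))
                                                         ≈⟨ ⊕-cong (⊕-cong (vanish quadV) (negS-cong (vanish quadV′))) ≋-refl ⟩
      (zeroS ⊕ negS zeroS) ⊕ (H ⊛ (S ⊛ D))               ≈⟨ (λ n → trans (+-congʳ (trans (+-congˡ -0#≈0#) (+-identityʳ _))) (+-identityˡ _)) ⟩
      H ⊛ (S ⊛ D)                                        ≈⟨ ⊛-assoc H S D ⟨
      (H ⊛ S) ⊛ D                                        ∎
      where
      vanish : ∀ {W} → Quadratic β p q H W → ((W ⊛ linearFactor β H W) ⊕ negS (linearFactor p H W ⊛ linearFactor q H W)) ≋ zeroS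
      vanish quadW n = trans (+-congʳ (quadW n)) (-‿inverseʳ _)

  comp-linearFactor : ∀ r F V → F 0 ≈ 0# → comp (linearFactor r X V) F ≋ linearFactor r F (comp V F)
  comp-linearFactor r F V F₀≈0 = begin
    comp (oneS ⊕ negS (constS r ⊛ (X ⊛ V))) F                 ≈⟨ comp-⊕ _ _ F ⟩
    comp oneS F ⊕ comp (negS (constS r ⊛ (X ⊛ V))) F          ≈⟨ ⊕-cong (comp-one F) (comp-neg _ F) ⟩
    oneS ⊕ negS (comp (constS r ⊛ (X ⊛ V)) F)
      ≈⟨ ⊕-cong {f = oneS} ≋-refl (negS-cong (≋-trans (comp-⊛ (constS r) (X ⊛ V))
           (⊛-cong (comp-const r F) (≋-trans (comp-⊛ X V) (⊛-cong {g = comp V F} comp-X ≋-refl))))) ⟩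
    oneS ⊕ negS (constS r ⊛ (F ⊛ comp V F))                   ∎
    where open Substitution F F₀≈0

  comp-quadratic : ∀ {β p q T} F → F 0 ≈ 0# → Quadratic β p q X T → Quadratic β p q F (comp T F)
  comp-quadratic {β} {p} {q} {T} F F₀≈0 quadT = begin
    comp T F ⊛ linearFactor β F (comp T F)                  ≈⟨ ⊛-cong {f = comp T F} ≋-refl (comp-linearFactor β F T F₀≈0) ⟨
    comp T F ⊛ comp (linearFactor β X T) F                  ≈⟨ comp-⊛ T _ ⟨
    comp (T ⊛ linearFactor β X T) F                         ≈⟨ comp-cong F quadT ⟩
    comp (linearFactor p X T ⊛ linearFactor q X T) F        ≈⟨ comp-⊛ _ _ ⟩
    comp (linearFactor p X T) F ⊛ comp (linearFactor q X T) F ≈⟨ ⊛-cong (comp-linearFactor p F T F₀≈0) (comp-linearFactor q F T F₀≈0) ⟩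
    linearFactor p F (comp T F) ⊛ linearFactor q F (comp T F) ∎
    where open Substitution F F₀≈0

module TransformOfE {c ℓ} (R : CommutativeRing c ℓ) where
  open CommutativeRing R
  open PowerSeries R
  open FormalSeries R
  open SeriesAlgebra R
  open SetoidReasoning ≋-setoid
  private
    module Scalar      = IntegerCoefficients R
    module Ordinary    = IntegerCoefficients ordinaryRing
    module Exponential = IntegerCoefficients exponentialRing

  module _ (a b y u : Carrier) (u*[1-y]≈1 : u * (1# - y) ≈ 1#) where

    -- E(t) = (1 − y) e^{−pt} / (1 − y e^{st})
    p s q β : Carrier
    p = a * (y - 1#)
    s = b * (1# - y)
    q = s + p
    β = b + p

    a[1-y]+p≈0 : a * (1# - y) + p ≈ 0#
    a[1-y]+p≈0 = solve 2 (λ a y → a :* (con (+ 1) :- y) :+ a :* (y :- con (+ 1)) := con (+ 0)) refl a y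
      where open Scalar

    a[1-y]+q≈s : a * (1# - y) + q ≈ s
    a[1-y]+q≈s = solve 3 (λ a y s → a :* (con (+ 1) :- y) :+ (s :+ a :* (y :- con (+ 1))) := s) refl a y s
      where open Scalar

    u-uy≈1 : u - u * y ≈ 1#
    u-uy≈1 = trans (solve 2 (λ u y → u :- u :* y := u :* (con (+ 1) :- y)) refl u y) u*[1-y]≈1
      where open Scalar

    uq-uyp≈β : u * q - (u * y) * p ≈ β
    uq-uyp≈β = trans (solve 4 (λ u y b p → u :* (b :* (con (+ 1) :- y) :+ p) :- (u :* y) :* p
                                           := (u :* (con (+ 1) :- y)) :* (b :+ p)) refl u y b p)
                     (trans (*-congʳ u*[1-y]≈1) (*-identityˡ β))
      where open Scalar

    β-p≈b : β - p ≈ b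
    β-p≈b = solve 2 (λ b p → (b :+ p) :- p := b) refl b p
      where open Scalar

    β-q≈by : β - q ≈ b * y
    β-q≈by = solve 3 (λ b p y → (b :+ p) :- (b :* (con (+ 1) :- y) :+ p) := b :* y) refl b p y
      where open Scalar

    E reciprocalE : Series
    E           = Eser a b y u
    reciprocalE = scaleS u (expS p ⊕ negS (scaleS y (expS q)))

    E⊙reciprocalE : (E ⊙ reciprocalE) ≋ oneS
    E⊙reciprocalE = begin
      E ⊙ reciprocalE
        ≈⟨ ⊙-cong (⊙-cong {g = I} (≋-sym (constS-⊙ (1# - y) eA)) ≋-refl)
                  (≋-sym (≋-trans (constS-⊙ u (expS p ⊕ negS (constS y ⊙ expS q))) (λ n → *-congˡ (+-congˡ (-‿cong (constS-⊙ y (expS q) n)))))) ⟩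
      ((constS (1# - y) ⊙ eA) ⊙ I) ⊙ (constS u ⊙ (expS p ⊕ negS (constS y ⊙ expS q)))
        ≈⟨ regroup (constS (1# - y)) (constS u) (constS y) eA (expS p) (expS q) I ⟩
      (constS (1# - y) ⊙ constS u) ⊙ (I ⊙ ((eA ⊙ expS p) ⊕ negS (constS y ⊙ (eA ⊙ expS q))))
        ≈⟨ ⊙-cong [1-y]u≋1 (⊙-cong {f = I} ≋-refl (⊕-cong eA⊙eP≋1 (negS-cong (≋-trans (⊙-cong {f = constS y} ≋-refl eA⊙eQ≋eS)
                                                                                          (constS-⊙ y (expS s)))))) ⟩
      oneS ⊙ (I ⊙ denE b y)                                ≈⟨ ⊙-identityˡ _ ⟩
      I ⊙ denE b y                                         ≈⟨ ⊙-comm I (denE b y) ⟩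
      denE b y ⊙ I                                         ≈⟨ egfInv-inverse u (denE b y) den₀u≈1 ⟩
      oneS                                                 ∎
      where
      I eA : Series
      I  = egfInv u (denE b y)
      eA = expS (a * (1# - y))
      den₀u≈1 : denE b y 0 * u ≈ 1#
      den₀u≈1 = trans (*-congʳ (+-congˡ (-‿cong (*-identityʳ y)))) (trans (*-comm _ _) u*[1-y]≈1)
      [1-y]u≋1 : (constS (1# - y) ⊙ constS u) ≋ oneS
      [1-y]u≋1 = ≋-trans (constS-⊙ (1# - y) (constS u))
        (λ n → trans (sym (*-assoc _ _ _)) (trans (*-congʳ (trans (*-comm _ _) u*[1-y]≈1)) (*-identityˡ _)))
      eA⊙eP≋1 : (eA ⊙ expS p) ≋ oneS
      eA⊙eP≋1 = ≋-trans (expS-+ _ _) (≋-trans (expS-cong a[1-y]+p≈0) expS-0)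
      eA⊙eQ≋eS : (eA ⊙ expS q) ≋ expS s
      eA⊙eQ≋eS = ≋-trans (expS-+ _ _) (expS-cong a[1-y]+q≈s)
      regroup : ∀ C₁ Cu Cy A P Q J →
        (((C₁ ⊙ A) ⊙ J) ⊙ (Cu ⊙ (P ⊕ negS (Cy ⊙ Q)))) ≋ ((C₁ ⊙ Cu) ⊙ (J ⊙ ((A ⊙ P) ⊕ negS (Cy ⊙ (A ⊙ Q)))))
      regroup = solve 7 (λ C₁ Cu Cy A P Q J → ((C₁ :* A) :* J) :* (Cu :* (P :- (Cy :* Q)))
                                              := (C₁ :* Cu) :* (J :* ((A :* P) :- (Cy :* (A :* Q))))) ≋-refl
        where open Exponential

    reciprocal-unique : egfInv 1# E ≋ reciprocalE
    reciprocal-unique = begin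
      g                          ≈⟨ ⊙-identityˡ g ⟨
      oneS ⊙ g                   ≈⟨ ⊙-cong {g = g} E⊙reciprocalE ≋-refl ⟨
      (E ⊙ reciprocalE) ⊙ g      ≈⟨ ⊙-cong {g = g} (⊙-comm E reciprocalE) ≋-refl ⟩
      (reciprocalE ⊙ E) ⊙ g      ≈⟨ ⊙-assoc reciprocalE E g ⟩
      reciprocalE ⊙ (E ⊙ g)      ≈⟨ ⊙-cong {f = reciprocalE} ≋-refl (egfInv-inverse 1# E E₀≈1) ⟩
      reciprocalE ⊙ oneS         ≈⟨ ⊙-comm reciprocalE oneS ⟩
      oneS ⊙ reciprocalE         ≈⟨ ⊙-identityˡ reciprocalE ⟩
      reciprocalE                ∎
      where
      g = egfInv 1# E
      E₀≈1 : E 0 * 1# ≈ 1#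
      E₀≈1 = trans (*-identityʳ _) (trans (natMul-1 _) (trans (*-congʳ (*-identityʳ _)) (trans (*-comm _ _) u*[1-y]≈1)))

    Rv T : Series
    Rv = Rev 1# (mulX (egfInv 1# E))
    T  = divX Rv

    Rv≋X⊛T : Rv ≋ (X ⊛ T)
    Rv≋X⊛T zero    = sym (X-⊛ T 0)
    Rv≋X⊛T (suc n) = sym (X-⊛ T (suc n))

    open Substitution Rv refl using (comp-geometric)

    K : Series
    K = scaleS u (comp (expS p) Rv ⊕ negS (scaleS y (comp (expS q) Rv)))

    T⊛K≋1 : (T ⊛ K) ≋ oneS
    T⊛K≋1 = X-⊛-cancel (begin
      X ⊛ (T ⊛ K)                           ≈⟨ ⊛-assoc X T K ⟨
      (X ⊛ T) ⊛ K                           ≈⟨ ⊛-cong {g = K} Rv≋X⊛T ≋-refl ⟨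
      Rv ⊛ K                                ≈⟨ ⊛-cong {f = Rv} ≋-refl K≋comp ⟨
      Rv ⊛ comp (egfInv 1# E) Rv            ≈⟨ (λ n → trans (+-congʳ (zeroˡ _)) (+-identityˡ _)) ⟨
      constS 0# ⊕ (Rv ⊛ comp (egfInv 1# E) Rv) ≈⟨ comp-horner (mulX (egfInv 1# E)) ⟨
      comp (mulX (egfInv 1# E)) Rv          ≈⟨ Rev-inverse (mulX (egfInv 1# E)) refl refl ⟩
      X                                     ≈⟨ ⊛-identityʳ X ⟨
      X ⊛ oneS                              ∎)
      where
      open Composition Rv refl using (comp-horner)
      K≋comp : comp (egfInv 1# E) Rv ≋ K
      K≋comp = ≋-trans (comp-cong Rv reciprocal-unique) (≋-trans (comp-scale u _ Rv) (λ n → *-congˡ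
        (trans (comp-⊕ _ _ Rv n) (+-congˡ (trans (comp-neg _ Rv n) (-‿cong (comp-scale y (expS q) Rv n)))))))

    T-quadratic : Quadratic β p q X T
    T-quadratic = ≋-sym (begin
      linearFactor p X T ⊛ linearFactor q X T
        ≈⟨ ⊛-cong (lin≋ p) (lin≋ q) ⟩
      LP ⊛ LQ                                                     ≈⟨ ⊛-identityˡ _ ⟨
      oneS ⊛ (LP ⊛ LQ)                                            ≈⟨ ⊛-cong {g = LP ⊛ LQ} T⊛K≋1 ≋-refl ⟨
      (T ⊛ K) ⊛ (LP ⊛ LQ)                                         ≈⟨ ⊛-cong {g = LP ⊛ LQ} (⊛-cong {f = T} ≋-refl K≋) ≋-refl ⟩
      (T ⊛ (Cu ⊛ (cP ⊕ negS (Cy ⊛ cQ)))) ⊛ (LP ⊛ LQ)              ≈⟨ distribute T Cu Cy cP cQ (constS p) (constS q) Rv ⟩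
      T ⊛ ((Cu ⊛ ((cP ⊛ LP) ⊛ LQ)) ⊕ negS ((Cu ⊛ Cy) ⊛ ((cQ ⊛ LQ) ⊛ LP)))
        ≈⟨ ⊛-cong {f = T} ≋-refl (⊕-cong (⊛-cong {f = Cu} ≋-refl (⊛-cong {g = LQ} (comp-geometric p) ≋-refl))
                                         (negS-cong (⊛-cong {f = Cu ⊛ Cy} ≋-refl (⊛-cong {g = LP} (comp-geometric q) ≋-refl)))) ⟩
      T ⊛ ((Cu ⊛ (oneS ⊛ LQ)) ⊕ negS ((Cu ⊛ Cy) ⊛ (oneS ⊛ LP)))    ≈⟨ collect T Cu Cy (constS p) (constS q) Rv ⟩
      T ⊛ ((Cu ⊕ negS (Cu ⊛ Cy)) ⊕ negS (((Cu ⊛ constS q) ⊕ negS ((Cu ⊛ Cy) ⊛ constS p)) ⊛ Rv))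
        ≈⟨ ⊛-cong {f = T} ≋-refl (⊕-cong u-uy≋1 (negS-cong (⊛-cong {g = Rv} uq-uyp≋β ≋-refl))) ⟩
      T ⊛ LB                                                      ≈⟨ ⊛-cong {f = T} ≋-refl (lin≋ β) ⟨
      T ⊛ linearFactor β X T                                      ∎)
      where
      Cu Cy cP cQ LP LQ LB : Series
      Cu = constS u
      Cy = constS y
      cP = comp (expS p) Rv
      cQ = comp (expS q) Rv
      LP = oneS ⊕ negS (constS p ⊛ Rv)
      LQ = oneS ⊕ negS (constS q ⊛ Rv)
      LB = oneS ⊕ negS (constS β ⊛ Rv)
      lin≋ : ∀ r → linearFactor r X T ≋ (oneS ⊕ negS (constS r ⊛ Rv))
      lin≋ r = ⊕-cong {f = oneS} ≋-refl (negS-cong (⊛-cong {f = constS r} ≋-refl (≋-sym Rv≋X⊛T)))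
      K≋ : K ≋ (Cu ⊛ (cP ⊕ negS (Cy ⊛ cQ)))
      K≋ = ≋-sym (≋-trans (constS-⊛ u _) (λ n → *-congˡ (+-congˡ (-‿cong (constS-⊛ y cQ n)))))
      u-uy≋1 : (Cu ⊕ negS (Cu ⊛ Cy)) ≋ oneS
      u-uy≋1 = ≋-trans (⊕-cong {f = Cu} ≋-refl (negS-cong (≋-sym (constS-* u y))))
        (≋-trans (constS-difference u (u * y) 1# u-uy≈1) constS-1)
      uq-uyp≋β : ((Cu ⊛ constS q) ⊕ negS ((Cu ⊛ Cy) ⊛ constS p)) ≋ constS β
      uq-uyp≋β = ≋-trans
        (⊕-cong (≋-sym (constS-* u q)) (negS-cong (≋-trans (⊛-cong {g = constS p} (≋-sym (constS-* u y)) ≋-refl)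
                                                            (≋-sym (constS-* (u * y) p)))))
        (constS-difference (u * q) ((u * y) * p) β uq-uyp≈β)
      open Ordinary
      distribute : ∀ T Cu Cy A B P Q H →
        ((T ⊛ (Cu ⊛ (A ⊕ negS (Cy ⊛ B)))) ⊛ ((oneS ⊕ negS (P ⊛ H)) ⊛ (oneS ⊕ negS (Q ⊛ H))))
        ≋ (T ⊛ ((Cu ⊛ ((A ⊛ (oneS ⊕ negS (P ⊛ H))) ⊛ (oneS ⊕ negS (Q ⊛ H))))
                ⊕ negS ((Cu ⊛ Cy) ⊛ ((B ⊛ (oneS ⊕ negS (Q ⊛ H))) ⊛ (oneS ⊕ negS (P ⊛ H))))))
      distribute = solve 8 (λ T Cu Cy A B P Q H →
        (T :* (Cu :* (A :- (Cy :* B)))) :* ((con (+ 1) :- (P :* H)) :* (con (+ 1) :- (Q :* H)))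
        := T :* ((Cu :* ((A :* (con (+ 1) :- (P :* H))) :* (con (+ 1) :- (Q :* H))))
                 :- ((Cu :* Cy) :* ((B :* (con (+ 1) :- (Q :* H))) :* (con (+ 1) :- (P :* H)))))) ≋-refl
      collect : ∀ T Cu Cy P Q H →
        (T ⊛ ((Cu ⊛ (oneS ⊛ (oneS ⊕ negS (Q ⊛ H)))) ⊕ negS ((Cu ⊛ Cy) ⊛ (oneS ⊛ (oneS ⊕ negS (P ⊛ H))))))
        ≋ (T ⊛ ((Cu ⊕ negS (Cu ⊛ Cy)) ⊕ negS (((Cu ⊛ Q) ⊕ negS ((Cu ⊛ Cy) ⊛ P)) ⊛ H)))
      collect = solve 6 (λ T Cu Cy P Q H →
        T :* ((Cu :* (con (+ 1) :* (con (+ 1) :- (Q :* H)))) :- ((Cu :* Cy) :* (con (+ 1) :* (con (+ 1) :- (P :* H)))))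
        := T :* ((Cu :- (Cu :* Cy)) :- (((Cu :* Q) :- ((Cu :* Cy) :* P)) :* H))) ≋-refl

    N Q N⁻¹ Q⁻¹ F G W Z : Series
    N   = numG a b y
    Q   = quadD b y
    N⁻¹ = ogfInv 1# N
    Q⁻¹ = ogfInv 1# Q
    F   = riordanF a b y
    G   = riordanG a b y
    W   = comp T F
    Z   = Q ⊛ N⁻¹

    N⊛N⁻¹≋1 : (N ⊛ N⁻¹) ≋ oneS
    N⊛N⁻¹≋1 = ogfInv-inverse 1# N (*-identityʳ 1#)

    Q⊛Q⁻¹≋1 : (Q ⊛ Q⁻¹) ≋ oneS
    Q⊛Q⁻¹≋1 = ogfInv-inverse 1# Q (*-identityʳ 1#)

    N≋1+βX : N ≋ (oneS ⊕ (constS β ⊛ X))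
    N≋1+βX n = trans (coefficient n) (sym (+-congˡ (constS-⊛ β X n)))
      where
      coefficient : ∀ n → N n ≈ oneS n + β * X n
      coefficient zero          = sym (trans (+-congˡ (zeroʳ β)) (+-identityʳ 1#))
      coefficient (suc zero)    = sym (trans (+-identityˡ _) (trans (*-identityʳ β) (+-comm b p)))
      coefficient (suc (suc n)) = sym (trans (+-identityˡ _) (zeroʳ β))

    Q≋[1+bX][1+byX] : Q ≋ ((oneS ⊕ (constS b ⊛ X)) ⊛ (oneS ⊕ (constS (b * y) ⊛ X)))
    Q≋[1+bX][1+byX] = begin
      Q
        ≈⟨ (λ n → trans (coefficient n) (sym (+-cong (+-congˡ (constS-⊛ c₁ X n))
                                                    (trans (constS-⊛ c₂ (X ⊛ X) n) (*-congˡ (X-⊛ X n)))))) ⟩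
      (oneS ⊕ (constS c₁ ⊛ X)) ⊕ (constS c₂ ⊛ (X ⊛ X))
        ≈⟨ ⊕-cong (⊕-cong {f = oneS} ≋-refl (⊛-cong {g = X} c₁≋ ≋-refl)) (⊛-cong {g = X ⊛ X} c₂≋ ≋-refl) ⟩
      (oneS ⊕ ((constS b ⊕ constS (b * y)) ⊛ X)) ⊕ ((constS b ⊛ constS (b * y)) ⊛ (X ⊛ X))
        ≈⟨ expand (constS b) (constS (b * y)) X ⟨
      (oneS ⊕ (constS b ⊛ X)) ⊛ (oneS ⊕ (constS (b * y) ⊛ X))
        ∎
      where
      c₁ c₂ : Carrier
      c₁ = b * (1# + y)
      c₂ = b * b * y
      coefficient : ∀ n → Q n ≈ oneS n + c₁ * X n + c₂ * mulX X n
      coefficient zero                = sym (trans (+-cong (trans (+-congˡ (zeroʳ c₁)) (+-identityʳ 1#)) (zeroʳ c₂)) (+-identityʳ 1#))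
      coefficient (suc zero)          = sym (trans (+-cong (trans (+-identityˡ _) (*-identityʳ c₁)) (zeroʳ c₂)) (+-identityʳ c₁))
      coefficient (suc (suc zero))    = sym (trans (+-cong (trans (+-identityˡ _) (zeroʳ c₁)) (*-identityʳ c₂)) (+-identityˡ c₂))
      coefficient (suc (suc (suc n))) = sym (trans (+-cong (trans (+-identityˡ _) (zeroʳ c₁)) (zeroʳ c₂)) (+-identityʳ 0#))
      c₁≋ : constS c₁ ≋ (constS b ⊕ constS (b * y))
      c₁≋ = ≋-trans (constS-cong (trans (distribˡ b 1# y) (+-congʳ (*-identityʳ b)))) (λ n → distribʳ _ _ _)
      c₂≋ : constS c₂ ≋ (constS b ⊛ constS (b * y))
      c₂≋ = ≋-trans (constS-cong (*-assoc b b y)) (constS-* b (b * y))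
      expand : ∀ B₁ B₂ H → ((oneS ⊕ (B₁ ⊛ H)) ⊛ (oneS ⊕ (B₂ ⊛ H))) ≋ ((oneS ⊕ ((B₁ ⊕ B₂) ⊛ H)) ⊕ ((B₁ ⊛ B₂) ⊛ (H ⊛ H)))
      expand = solve 3 (λ B₁ B₂ H → (con (+ 1) :+ (B₁ :* H)) :* (con (+ 1) :+ (B₂ :* H))
                                    := (con (+ 1) :+ ((B₁ :+ B₂) :* H)) :+ ((B₁ :* B₂) :* (H :* H))) ≋-refl
        where open Ordinary

    linearFactor-Z : ∀ r → linearFactor r F Z ≋ ((N ⊕ negS (constS r ⊛ X)) ⊛ N⁻¹)
    linearFactor-Z r = begin
      oneS ⊕ negS (constS r ⊛ (F ⊛ Z))                   ≈⟨ ⊕-cong (≋-sym N⊛N⁻¹≋1) (negS-cong (⊛-cong {f = constS r} ≋-refl F⊛Z≋X⊛N⁻¹)) ⟩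
      (N ⊛ N⁻¹) ⊕ negS (constS r ⊛ (X ⊛ N⁻¹))            ≈⟨ factor N N⁻¹ (constS r) X ⟩
      (N ⊕ negS (constS r ⊛ X)) ⊛ N⁻¹                    ∎
      where
      open Ordinary
      regroup : ∀ H A B C → ((H ⊛ A) ⊛ (B ⊛ C)) ≋ (H ⊛ ((B ⊛ A) ⊛ C))
      regroup = solve 4 (λ H A B C → (H :* A) :* (B :* C) := H :* ((B :* A) :* C)) ≋-refl
      factor : ∀ M M′ C H → ((M ⊛ M′) ⊕ negS (C ⊛ (H ⊛ M′))) ≋ ((M ⊕ negS (C ⊛ H)) ⊛ M′)
      factor = solve 4 (λ M M′ C H → (M :* M′) :- (C :* (H :* M′)) := (M :- (C :* H)) :* M′) ≋-refl
      F⊛Z≋X⊛N⁻¹ : (F ⊛ Z) ≋ (X ⊛ N⁻¹)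
      F⊛Z≋X⊛N⁻¹ = begin
        F ⊛ (Q ⊛ N⁻¹)              ≈⟨ ⊛-cong {g = Z} (≋-sym (X-⊛ Q⁻¹)) ≋-refl ⟩
        (X ⊛ Q⁻¹) ⊛ (Q ⊛ N⁻¹)      ≈⟨ regroup X Q⁻¹ Q N⁻¹ ⟩
        X ⊛ ((Q ⊛ Q⁻¹) ⊛ N⁻¹)      ≈⟨ ⊛-cong {f = X} ≋-refl (≋-trans (⊛-cong {g = N⁻¹} Q⊛Q⁻¹≋1 ≋-refl) (⊛-identityˡ N⁻¹)) ⟩
        X ⊛ N⁻¹                    ∎

    N-shift : ∀ r d → β - r ≈ d → (N ⊕ negS (constS r ⊛ X)) ≋ (oneS ⊕ (constS d ⊛ X))
    N-shift r d β-r≈d = begin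
      N ⊕ negS (constS r ⊛ X)                          ≈⟨ ⊕-cong N≋1+βX ≋-refl ⟩
      (oneS ⊕ (constS β ⊛ X)) ⊕ negS (constS r ⊛ X)    ≈⟨ collect (constS β) (constS r) X ⟩
      oneS ⊕ ((constS β ⊕ negS (constS r)) ⊛ X)        ≈⟨ ⊕-cong {f = oneS} ≋-refl (⊛-cong {g = X} (constS-difference β r d β-r≈d) ≋-refl) ⟩
      oneS ⊕ (constS d ⊛ X)                            ∎
      where
      collect : ∀ B C H → ((oneS ⊕ (B ⊛ H)) ⊕ negS (C ⊛ H)) ≋ (oneS ⊕ ((B ⊕ negS C) ⊛ H))
      collect = solve 3 (λ B C H → (con (+ 1) :+ (B :* H)) :- (C :* H) := con (+ 1) :+ ((B :- C) :* H)) ≋-refl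
        where open Ordinary

    Z-quadratic : Quadratic β p q F Z
    Z-quadratic = begin
      Z ⊛ linearFactor β F Z                                       ≈⟨ ⊛-cong {f = Z} ≋-refl linearFactor-β≋N⁻¹ ⟩
      (Q ⊛ N⁻¹) ⊛ N⁻¹                                              ≈⟨ ⊛-assoc Q N⁻¹ N⁻¹ ⟩
      Q ⊛ (N⁻¹ ⊛ N⁻¹)                                              ≈⟨ ⊛-cong {g = N⁻¹ ⊛ N⁻¹} Q≋[1+bX][1+byX] ≋-refl ⟩
      ((oneS ⊕ (constS b ⊛ X)) ⊛ (oneS ⊕ (constS (b * y) ⊛ X))) ⊛ (N⁻¹ ⊛ N⁻¹) ≈⟨ interchange _ _ N⁻¹ ⟨
      ((oneS ⊕ (constS b ⊛ X)) ⊛ N⁻¹) ⊛ ((oneS ⊕ (constS (b * y) ⊛ X)) ⊛ N⁻¹)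
        ≈⟨ ⊛-cong (≋-trans (linearFactor-Z p) (⊛-cong {g = N⁻¹} (N-shift p b β-p≈b) ≋-refl))
                  (≋-trans (linearFactor-Z q) (⊛-cong {g = N⁻¹} (N-shift q (b * y) β-q≈by) ≋-refl)) ⟨
      linearFactor p F Z ⊛ linearFactor q F Z                      ∎
      where
      1+0X≋1 : (oneS ⊕ (constS 0# ⊛ X)) ≋ oneS
      1+0X≋1 n = trans (+-congˡ (trans (constS-⊛ 0# X n) (zeroˡ _))) (+-identityʳ _)
      linearFactor-β≋N⁻¹ : linearFactor β F Z ≋ N⁻¹
      linearFactor-β≋N⁻¹ = ≋-trans (linearFactor-Z β)
        (≋-trans (⊛-cong {g = N⁻¹} (≋-trans (N-shift β 0# (-‿inverseʳ β)) 1+0X≋1) ≋-refl) (⊛-identityˡ N⁻¹))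
      interchange : ∀ A B C → ((A ⊛ C) ⊛ (B ⊛ C)) ≋ ((A ⊛ B) ⊛ (C ⊛ C))
      interchange = solve 3 (λ A B C → (A :* C) :* (B :* C) := (A :* B) :* (C :* C)) ≋-refl
        where open Ordinary

    W≋Z : W ≋ Z
    W≋Z = quadratic-unique refl (comp-quadratic F refl T-quadratic) Z-quadratic

    G⊛W≋1 : (G ⊛ W) ≋ oneS
    G⊛W≋1 = begin
      G ⊛ W                       ≈⟨ ⊛-cong {f = G} ≋-refl W≋Z ⟩
      (N ⊛ Q⁻¹) ⊛ (Q ⊛ N⁻¹)       ≈⟨ swap N Q⁻¹ Q N⁻¹ ⟩
      (N ⊛ N⁻¹) ⊛ (Q ⊛ Q⁻¹)       ≈⟨ ⊛-cong N⊛N⁻¹≋1 Q⊛Q⁻¹≋1 ⟩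
      oneS ⊛ oneS                 ≈⟨ ⊛-identityˡ oneS ⟩
      oneS                        ∎
      where
      swap : ∀ A B C D → ((A ⊛ B) ⊛ (C ⊛ D)) ≋ ((A ⊛ D) ⊛ (C ⊛ B))
      swap = solve 4 (λ A B C D → (A :* B) :* (C :* D) := (A :* D) :* (C :* B)) ≋-refl
        where open Ordinary

    riordanArray-diagonal : ∀ n → riordanArray a b y n n ≈ 1#
    riordanArray-diagonal = riordan-diagonal G F (*-identityˡ 1#) refl refl

    T≋moments : T ≋ moments (riordanArray a b y)
    T≋moments = moments-unique (riordanArray a b y) T riordanArray-diagonal
      (λ n → trans (riordan-action G F T refl n) (G⊛W≋1 n))

mainTheorem4 : ∀ {c ℓ} (R : CommutativeRing c ℓ) →
    let open CommutativeRing R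
        open PowerSeries R
    in (a b y u : Carrier) → u * (1# - y) ≈ 1# →
       (∀ n → riordanArray a b y n n ≈ 1#) ×
       (𝒯 (Eser a b y u) ≋ moments (riordanArray a b y))
mainTheorem4 R a b y u u*[1-y]≈1 =
  riordanArray-diagonal a b y u u*[1-y]≈1 , T≋moments a b y u u*[1-y]≈1
  where open TransformOfE R
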